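{- Consider an adaptive Fibonacci heap $H$ (as defined in the context) after any sequence of operations. Let $x$ be any node of $H$ and let $k = x.degree$. Let $y_1, y_2, \dots, y_k$ denote the children of $x$ in the order in which they were linked to $x$, from earliest to latest. Then $y_1.degree \geq 0$ and $y_i.degree \geq i-2$ for $i = 2, 3, \dots, k$.
   Context: An adaptive Fibonacci heap $H$ storing $H.n$ elements with totally ordered keys is a collection of heap-ordered rooted trees (every node's key is at least its parent's key); comparisons $x<y$ between nodes compare keys. Each node $x$ stores a key, a parent pointer $x.parent$ (NIL for roots), a circular doubly linked list of its children, $x.degree$ = its number of children, and a boolean mark. The roots form a circular doubly linked root list; $H.min$ points to a root of minimum key. All lists are iterated from the oldest-added element to the newest-added one. "Linking $y$ as a child of $x$" means removing $y$ from its current list, making it a child of $x$, incrementing $x.degree$, and unmarking $y$. INSERT, FIND-MIN, UNION and DECREASE-KEY are exactly those of the Fibonacci heap (Cormen–Leiserson–Rivest–Stein, Ch. 19): INSERT adds a new unmarked root of degree 0; UNION concatenates root lists; DECREASE-KEY$(x,k)$ lowers the key of $x$ and, if now $x<x.parent=y$, cuts $x$ (moves it, unmarked, to the root list, decrementing $y.degree$) and then performs a cascading cut on $y$: if $y$ is not a root, then if $y$ is unmarked it is marked, and if it is marked it is cut and the cascading cut recurses on its parent. EXTRACT-MIN$(H)$: remove $z=H.min$ from the root list, move every child of $z$ to the root list with parent NIL; if the root list becomes empty set $H.min=$ NIL, otherwise call CONSOLIDATE$(H)$; decrement $H.n$; return $z$. CONSOLIDATE$(H)$: allocate an array $A[0\dots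 D(H.n)]$ with all entries NIL (where $D(n)$ is an upper bound on the maximum degree); for each node $x$ of the root list (in list order) call APPEND$(x, x.degree, A)$; then create a new empty root list and, for each non-NIL entry $x$ of $A$ with $x.parent=$ NIL, insert $x$ into the root list, updating $H.min$ if $x<H.min$. APPEND$(x,d,A)$: let $y=A[d]$. If $y=$ NIL, nothing else is done before the final step. Else if $y<x$: if $y.degree=d$, link $x$ as a child of $y$; then, if $y.parent=$ NIL, call APPEND$(y, y.degree, A)$. Else (i.e. $y\ge x$), if $y.parent=$ NIL, link $y$ as a child of $x$. Finally, in all cases, set $A[d]=x$. -}

module Defs where

open import Level using (_⊔_)
open import Data.Nat using (ℕ; zero; suc; _≡ᵇ_; _∸_; _+_)
open import Data.Bool using (Bool; true; false; if_then_else_; not; T?)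
open import Data.List using (List; []; _∷_; _++_; [_]; length; filter; foldl)
open import Data.Maybe using (Maybe; just; nothing)
open import Data.Product using (_×_; _,_)
open import Data.Sum using (_⊎_)
open import Relation.Nullary using (¬_; does)
open import Relation.Binary.PropositionalEquality using (_≡_)
open import Relation.Binary.Bundles using (StrictTotalOrder)

-- Operations are given as (big-step) relations, so that
-- possibly non-terminating recursions (APPEND, cascading cut) need no
-- termination argument: a state is reachable only via terminating runs.

module FibHeap {a ℓ₁ ℓ₂} (O : StrictTotalOrder a ℓ₁ ℓ₂) where

  open StrictTotalOrder O using (Carrier; _<_; _<?_)

  Id : Set
  Id = ℕ

  record Node : Set a where
    field
      key      : Carrier
      parent   : Maybe Id
      children : List Id         -- oldest-added first
      mark     : Bool
  open Node public

  degree : Node → ℕ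
  degree n = length (children n)

  Store : Set a
  Store = Id → Maybe Node

  record Heap : Set a where
    field
      store : Store
      roots : List Id              -- root list, oldest-added first
      min   : Maybe Id
      size  : ℕ
  open Heap public

  removeId : Id → List Id → List Id
  removeId x = filter (λ y → T? (not (y ≡ᵇ x)))

  setNode : Store → Id → Maybe Node → Store
  setNode s i v j = if j ≡ᵇ i then v else s j

  modify : Store → Id → (Node → Node) → Store
  modify s i f j with j ≡ᵇ i | s j
  ... | true  | just n  = just (f n)
  ... | true  | nothing = nothing
  ... | false | v       = v

  setParent : Maybe Id → Node → Node
  setParent p n = record n { parent = p }

  unmark : Node → Node
  unmark n = record n { mark = false }

  markNode : Node → Node
  markNode n = record n { mark = true }

  addChild : Id → Node → Node
  addChild c n = record n { children = children n ++ [ c ] }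

  dropChild : Id → Node → Node
  dropChild c n = record n { children = removeId c (children n) }

  setKey : Carrier → Node → Node
  setKey k n = record n { key = k }

  _<ᵇ_ : Carrier → Carrier → Bool
  k <ᵇ k' = does (k <? k')

  link : Heap → (y x : Id) → Heap
  link H y x with store H y
  ... | nothing = H
  ... | just ny with parent ny
  ...   | nothing = record H
          { store = modify (modify (store H) y (λ n → unmark (setParent (just x) n)))
                           x (addChild y)
          ; roots = removeId y (roots H) }
  ...   | just p = record H
          { store = modify (modify (modify (store H) p (dropChild y))
                                   y (λ n → unmark (setParent (just x) n)))
                           x (addChild y) }

  -- current degree of a node (0 if absent; never used on absent nodes in
  -- well-formed states)
  degOf : Heap → Id → ℕ
  degOf H i with store H i
  ... | just n  = degree n
  ... | nothing = 0

  emptyHeap : Heap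
  emptyHeap = record { store = λ _ → nothing ; roots = [] ; min = nothing ; size = 0 }

  newMin : Store → Maybe Id → Id → Carrier → Maybe Id
  newMin s nothing  x k = just x
  newMin s (just m) x k with s m
  ... | nothing = just x
  ... | just nm = if k <ᵇ key nm then just x else just m

  insertH : Heap → Id → Carrier → Heap
  insertH H x k = record
    { store = setNode (store H) x (just record { key = k ; parent = nothing
                                                ; children = [] ; mark = false })
    ; roots = roots H ++ [ x ]
    ; min   = newMin (store H) (min H) x k
    ; size  = suc (size H) }

  Disjoint : Heap → Heap → Set a
  Disjoint H₁ H₂ = ∀ i → store H₁ i ≡ nothing ⊎ store H₂ i ≡ nothing

  mergeStore : Store → Store → Store
  mergeStore s₁ s₂ i with s₁ i
  ... | just n  = just n
  ... | nothing = s₂ i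

  unionMin : Heap → Heap → Maybe Id
  unionMin H₁ H₂ with min H₁ | min H₂
  ... | nothing | m₂ = m₂
  ... | just m₁ | nothing = just m₁
  ... | just m₁ | just m₂ with store H₁ m₁ | store H₂ m₂
  ...   | just n₁ | just n₂ = if key n₂ <ᵇ key n₁ then just m₂ else just m₁
  ...   | _       | _       = just m₁

  unionH : Heap → Heap → Heap
  unionH H₁ H₂ = record
    { store = mergeStore (store H₁) (store H₂)
    ; roots = roots H₁ ++ roots H₂
    ; min   = unionMin H₁ H₂
    ; size  = size H₁ + size H₂ }

  -- The array A of CONSOLIDATE: a list of optional node ids, index d = A[d];
  -- indices beyond the end hold NIL (an array A[0..D(n)] with D(n) a valid
  -- degree bound behaves identically).

  Arr : Set
  Arr = List (Maybe Id)

  getA : Arr → ℕ → Maybe Id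
  getA []       _       = nothing
  getA (v ∷ _)  zero    = v
  getA (_ ∷ vs) (suc d) = getA vs d

  setA : Arr → ℕ → Id → Arr
  setA []       zero    x = just x ∷ []
  setA []       (suc d) x = nothing ∷ setA [] d x
  setA (_ ∷ vs) zero    x = just x ∷ vs
  setA (v ∷ vs) (suc d) x = v ∷ setA vs d x

  -- APPEND(x, d, A): Append H A x d H' A'  means that running APPEND(x,d,A)
  -- on heap H with array A terminates with heap H' and array A'.
  data Append : Heap → Arr → Id → ℕ → Heap → Arr → Set (a ⊔ ℓ₂) where
    app-nil : ∀ {H A x d} → getA A d ≡ nothing →
              Append H A x d H (setA A d x)
    app-lt-root : ∀ {H A x d y nx ny H₂ A₂} →
              getA A d ≡ just y → store H x ≡ just nx → store H y ≡ just ny →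
              key ny < key nx → parent ny ≡ nothing →
              let H₁ = if degree ny ≡ᵇ d then link H x y else H in
              Append H₁ A y (degOf H₁ y) H₂ A₂ →
              Append H A x d H₂ (setA A₂ d x)
    app-lt-child : ∀ {H A x d y nx ny p} →
              getA A d ≡ just y → store H x ≡ just nx → store H y ≡ just ny →
              key ny < key nx → parent ny ≡ just p →
              let H₁ = if degree ny ≡ᵇ d then link H x y else H in
              Append H A x d H₁ (setA A d x)
    app-ge-root : ∀ {H A x d y nx ny} →
              getA A d ≡ just y → store H x ≡ just nx → store H y ≡ just ny →
              ¬ (key ny < key nx) → parent ny ≡ nothing →
              Append H A x d (link H y x) (setA A d x)
    app-ge-child : ∀ {H A x d y nx ny p} →
              getA A d ≡ just y → store H x ≡ just nx → store H y ≡ just ny →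
              ¬ (key ny < key nx) → parent ny ≡ just p →
              Append H A x d H (setA A d x)

  data AppendAll : Heap → Arr → List Id → Heap → Arr → Set (a ⊔ ℓ₂) where
    aa-nil  : ∀ {H A} → AppendAll H A [] H A
    aa-cons : ∀ {H A x xs H₁ A₁ H₂ A₂} →
              Append H A x (degOf H x) H₁ A₁ →
              AppendAll H₁ A₁ xs H₂ A₂ →
              AppendAll H A (x ∷ xs) H₂ A₂

  rebuild : Store → Arr → List Id → Maybe Id → (List Id × Maybe Id)
  rebuild s []             rs m = rs , m
  rebuild s (nothing ∷ vs) rs m = rebuild s vs rs m
  rebuild s (just x ∷ vs)  rs m with s x
  ... | nothing = rebuild s vs rs m
  ... | just nx with parent nx
  ...   | just _  = rebuild s vs rs m
  ...   | nothing = rebuild s vs (rs ++ [ x ]) (newMin s m x (key nx))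

  finishConsolidate : Heap → Arr → Heap
  finishConsolidate H A with rebuild (store H) A [] nothing
  ... | rs , m = record H { roots = rs ; min = m }

  data Consolidate : Heap → Heap → Set (a ⊔ ℓ₂) where
    consolidate : ∀ {H H₁ A₁} →
                  AppendAll H [] (roots H) H₁ A₁ →
                  Consolidate H (finishConsolidate H₁ A₁)

  orphan : Store → List Id → Store
  orphan s []       = s
  orphan s (c ∷ cs) = orphan (modify s c (setParent nothing)) cs

  removeMin : Heap → Id → Node → Heap
  removeMin H z nz = record
    { store = setNode (orphan (store H) (children nz)) z nothing
    ; roots = removeId z (roots H) ++ children nz
    ; min   = min H
    ; size  = size H ∸ 1 }

  data ExtractMin : Heap → Heap → Set (a ⊔ ℓ₂) where
    extract-empty : ∀ {H z nz} → min H ≡ just z → store H z ≡ just nz →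
                    roots (removeMin H z nz) ≡ [] →
                    ExtractMin H (record (removeMin H z nz) { min = nothing })
    extract-cons  : ∀ {H z nz r rs H'} → min H ≡ just z → store H z ≡ just nz →
                    roots (removeMin H z nz) ≡ r ∷ rs →
                    Consolidate (removeMin H z nz) H' →
                    ExtractMin H H'

  cut : Heap → (x y : Id) → Heap
  cut H x y = record H
    { store = modify (modify (store H) y (dropChild x))
                     x (λ n → unmark (setParent nothing n))
    ; roots = roots H ++ [ x ] }

  data CascadingCut : Heap → Id → Heap → Set (a ⊔ ℓ₂) where
    cc-root   : ∀ {H y ny} → store H y ≡ just ny → parent ny ≡ nothing →
                CascadingCut H y H
    cc-mark   : ∀ {H y ny z} → store H y ≡ just ny → parent ny ≡ just z →
                mark ny ≡ false →
                CascadingCut H y (record H { store = modify (store H) y markNode })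
    cc-cut    : ∀ {H y ny z H'} → store H y ≡ just ny → parent ny ≡ just z →
                mark ny ≡ true →
                CascadingCut (cut H y z) z H' →
                CascadingCut H y H'

  withKey : Heap → Id → Carrier → Heap
  withKey H x k = record H { store = modify (store H) x (setKey k) }

  updMin : Heap → Id → Carrier → Heap
  updMin H x k = record H { min = newMin (store H) (min H) x k }

  data DecreaseKey : Heap → Id → Carrier → Heap → Set (a ⊔ ℓ₂) where
    dk-nocut-root : ∀ {H x nx k} → store H x ≡ just nx → ¬ (key nx < k) →
                    parent nx ≡ nothing →
                    DecreaseKey H x k (updMin (withKey H x k) x k)
    dk-nocut      : ∀ {H x nx k y ny} → store H x ≡ just nx → ¬ (key nx < k) →
                    parent nx ≡ just y → store H y ≡ just ny → ¬ (k < key ny) →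
                    DecreaseKey H x k (updMin (withKey H x k) x k)
    dk-cut        : ∀ {H x nx k y ny H'} → store H x ≡ just nx → ¬ (key nx < k) →
                    parent nx ≡ just y → store H y ≡ just ny → k < key ny →
                    CascadingCut (cut (withKey H x k) x y) y H' →
                    DecreaseKey H x k (updMin H' x k)

  -- Heaps reachable by any sequence of operations (MAKE-HEAP, INSERT,
  -- UNION, EXTRACT-MIN, DECREASE-KEY; FIND-MIN does not change the heap)

  data Reachable : Heap → Set (a ⊔ ℓ₂) where
    r-empty    : Reachable emptyHeap
    r-insert   : ∀ {H} → Reachable H → (x : Id) → store H x ≡ nothing →
                 (k : Carrier) → Reachable (insertH H x k)
    r-union    : ∀ {H₁ H₂} → Reachable H₁ → Reachable H₂ → Disjoint H₁ H₂ →
                 Reachable (unionH H₁ H₂)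
    r-extract  : ∀ {H H'} → Reachable H → ExtractMin H H' → Reachable H'
    r-decrease : ∀ {H x k H'} → Reachable H → DecreaseKey H x k H' → Reachable H'

-- Every reachable heap satisfies an invariant that contains the bound: the child of x at
-- position i (counting from 0) has degree + [marked] ≥ i. A node c becomes a child only when
-- APPEND links it, unmarked, below a node q with degree q ≤ degree c, at position degree q.
-- Afterwards positions only decrease, and c loses a child only through a cut: the first loss
-- marks c, the second cuts c loose from its parent. Between a cut and the cascading cut on the
-- parent, one unit of slack records the parent's missing child. The other components of the
-- invariant (consistent parent and child pointers, finite parent chains, heap order, the root
-- list and the minimum pointer) are needed to show that the operations preserve it.

module Submission where

open import Defs
open import Data.Bool using (true; false; if_then_else_; not; T)
open import Data.Empty using (⊥-elim)
open import Data.Fin using (Fin; toℕ) renaming (zero to fzero; suc to fsuc)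
open import Data.List using (List; []; _∷_; _++_; [_]; length; lookup)
open import Data.List.Membership.Propositional using (_∈_; _∉_)
open import Data.List.Membership.Propositional.Properties using (∈-++⁺ˡ; ∈-++⁺ʳ; ∈-++⁻; ∈-filter⁺; ∈-filter⁻)
open import Data.List.Properties using (length-++)
open import Data.List.Relation.Unary.All using ([])
open import Data.List.Relation.Unary.Any using (here; there)
open import Data.List.Relation.Unary.Unique.Propositional using (Unique; []; _∷_; tail)
import Data.List.Relation.Unary.Unique.Propositional.Properties as Unique
open import Data.Maybe using (Maybe; just; nothing)
import Data.Maybe as Maybe
open import Data.Maybe.Properties using (just-injective)
open import Data.Nat using (ℕ; zero; suc; pred; _≡ᵇ_; _∸_; _+_; _≤_; _<_; z≤n; s≤s)
open import Data.Nat.Properties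
open import Data.List.Membership.DecPropositional _≟_ using (_∈?_)
open import Data.Product using (Σ; _×_; _,_; proj₁; proj₂)
open import Data.Sum using (_⊎_; inj₁; inj₂; map₂)
open import Data.Unit using (⊤; tt)
open import Function using (_∘_; case_of_)
open import Level using (_⊔_)
open import Relation.Binary.Bundles using (StrictTotalOrder)
open import Relation.Binary.Definitions using (tri<; tri≈; tri>)
open import Relation.Binary.PropositionalEquality hiding ([_])
open import Relation.Nullary using (¬_; does; yes; no)

≡ᵇ-true⇒≡ : ∀ {m n} → (m ≡ᵇ n) ≡ true → m ≡ n
≡ᵇ-true⇒≡ {m} {n} e = ≡ᵇ⇒≡ m n (subst T (sym e) tt)

≡ᵇ-false⇒≢ : ∀ {m n} → (m ≡ᵇ n) ≡ false → m ≢ n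
≡ᵇ-false⇒≢ {m} e refl = subst T e (≡⇒≡ᵇ m m refl)

≡ᵇ-refl : ∀ m → (m ≡ᵇ m) ≡ true
≡ᵇ-refl m with m ≡ᵇ m in e
... | true  = refl
... | false = ⊥-elim (≡ᵇ-false⇒≢ {m} {m} e refl)

≢⇒≡ᵇ-false : ∀ {m n} → m ≢ n → (m ≡ᵇ n) ≡ false
≢⇒≡ᵇ-false {m} {n} m≢n with m ≡ᵇ n in e
... | true  = ⊥-elim (m≢n (≡ᵇ-true⇒≡ e))
... | false = refl

module _ {ℓ} {A : Set ℓ} {m : Maybe A} where

  ≡just-unique : ∀ {u w} → m ≡ just u → m ≡ just w → u ≡ w
  ≡just-unique refl refl = refl

  ≡just⇒≢nothing : ∀ {u} → m ≡ just u → m ≢ nothing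
  ≡just⇒≢nothing refl ()

module _ {a ℓ₁ ℓ₂} (O : StrictTotalOrder a ℓ₁ ℓ₂) where

  open FibHeap O
  open StrictTotalOrder O using (Carrier; compare) renaming (_<_ to _≺_; _<?_ to _≺?_)

  module Ord = StrictTotalOrder O

  _≼_ : Carrier → Carrier → Set ℓ₂
  k ≼ k′ = ¬ (k′ ≺ k)

  ≼-refl : ∀ {k} → k ≼ k
  ≼-refl = Ord.irrefl Ord.Eq.refl

  ≼-trans : ∀ {k k′ k″} → k ≼ k′ → k′ ≼ k″ → k ≼ k″
  ≼-trans {k} {k′} {k″} k≼k′ k′≼k″ k″≺k with compare k″ k′
  ... | tri< k″≺k′ _ _ = k′≼k″ k″≺k′
  ... | tri≈ _ k″≈k′ _ = k≼k′ (Ord.<-respˡ-≈ k″≈k′ k″≺k)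
  ... | tri> _ _ k′≺k″ = k≼k′ (Ord.trans k′≺k″ k″≺k)

  ≺⇒≼ : ∀ {k k′} → k ≺ k′ → k ≼ k′
  ≺⇒≼ k≺k′ k′≺k = ≼-refl (Ord.trans k≺k′ k′≺k)

  ≺-≼-trans : ∀ {k k′ k″} → k ≺ k′ → k′ ≼ k″ → k ≼ k″
  ≺-≼-trans k≺k′ k′≼k″ k″≺k = k′≼k″ (Ord.trans k″≺k k≺k′)

  modify-≡ : ∀ s i f → modify s i f i ≡ Maybe.map f (s i)
  modify-≡ s i f with i ≡ᵇ i in e | s i
  ... | true  | just _  = refl
  ... | true  | nothing = refl
  ... | false | _       = ⊥-elim (≡ᵇ-false⇒≢ {i} {i} e refl)

  modify-≢ : ∀ s i f j → j ≢ i → modify s i f j ≡ s j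
  modify-≢ s i f j j≢i with j ≡ᵇ i in e | s j
  ... | true  | _ = ⊥-elim (j≢i (≡ᵇ-true⇒≡ e))
  ... | false | _ = refl

  modify-just : ∀ s i {n} f → s i ≡ just n → modify s i f i ≡ just (f n)
  modify-just s i f e = trans (modify-≡ s i f) (cong (Maybe.map f) e)

  setNode-≡ : ∀ s i v → setNode s i v i ≡ v
  setNode-≡ s i v rewrite ≡ᵇ-refl i = refl

  setNode-≢ : ∀ s i v j → j ≢ i → setNode s i v j ≡ s j
  setNode-≢ s i v j j≢i rewrite ≢⇒≡ᵇ-false j≢i = refl

  ∈-removeId⁻ : ∀ {z} y l → z ∈ removeId y l → z ∈ l × z ≢ y
  ∈-removeId⁻ y l z∈ with ∈-filter⁻ _ {xs = l} z∈
  ... | z∈l , ok = z∈l , λ { refl → subst T (cong not (≡ᵇ-refl y)) ok }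

  ∈-removeId⁺ : ∀ {z} y l → z ∈ l → z ≢ y → z ∈ removeId y l
  ∈-removeId⁺ {z} y l z∈l z≢y = ∈-filter⁺ _ z∈l (subst (T ∘ not) (sym (≢⇒≡ᵇ-false z≢y)) tt)

  removeId-∉ : ∀ y l → y ∉ l → removeId y l ≡ l
  removeId-∉ y [] _ = refl
  removeId-∉ y (w ∷ l) y∉ with w ≡ᵇ y in e
  ... | true  = ⊥-elim (y∉ (here (sym (≡ᵇ-true⇒≡ e))))
  ... | false = cong (w ∷_) (removeId-∉ y l (y∉ ∘ there))

  length-removeId : ∀ y l → Unique l → length l ≤ suc (length (removeId y l))
  length-removeId y [] _ = z≤n
  length-removeId y (w ∷ l) u@(_ ∷ u′) with w ≡ᵇ y in e
  ... | true rewrite removeId-∉ y l (subst (_∉ l) (≡ᵇ-true⇒≡ e) (Unique.Unique[x∷xs]⇒x∉xs u)) = ≤-refl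
  ... | false = s≤s (length-removeId y l u′)

  getA-[] : ∀ e → getA [] e ≡ nothing
  getA-[] zero    = refl
  getA-[] (suc e) = refl

  getA-setA-≡ : ∀ A d x → getA (setA A d x) d ≡ just x
  getA-setA-≡ []      zero    x = refl
  getA-setA-≡ []      (suc d) x = getA-setA-≡ [] d x
  getA-setA-≡ (_ ∷ A) zero    x = refl
  getA-setA-≡ (_ ∷ A) (suc d) x = getA-setA-≡ A d x

  getA-setA-≢ : ∀ A d x e → e ≢ d → getA (setA A d x) e ≡ getA A e
  getA-setA-≢ []      zero    x zero    e≢d = ⊥-elim (e≢d refl)
  getA-setA-≢ []      zero    x (suc e) e≢d = getA-[] e
  getA-setA-≢ []      (suc d) x zero    e≢d = refl
  getA-setA-≢ []      (suc d) x (suc e) e≢d = getA-setA-≢ [] d x e (e≢d ∘ cong suc)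
  getA-setA-≢ (_ ∷ A) zero    x zero    e≢d = ⊥-elim (e≢d refl)
  getA-setA-≢ (_ ∷ A) zero    x (suc e) e≢d = refl
  getA-setA-≢ (_ ∷ A) (suc d) x zero    e≢d = refl
  getA-setA-≢ (_ ∷ A) (suc d) x (suc e) e≢d = getA-setA-≢ A d x e (e≢d ∘ cong suc)

  _∈A?_ : ∀ v A → (Σ ℕ λ e → getA A e ≡ just v) ⊎ (∀ e → getA A e ≢ just v)
  v ∈A? [] = inj₂ λ e q → ≡just⇒≢nothing q (getA-[] e)
  v ∈A? (nothing ∷ A) with v ∈A? A
  ... | inj₁ (e , q) = inj₁ (suc e , q)
  ... | inj₂ h       = inj₂ λ { zero () ; (suc e) → h e }
  v ∈A? (just w ∷ A) with w ≟ v | v ∈A? A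
  ... | yes refl | _           = inj₁ (zero , refl)
  ... | no w≢v   | inj₁ (e , q) = inj₁ (suc e , q)
  ... | no w≢v   | inj₂ h       = inj₂ λ { zero q → w≢v (just-injective q) ; (suc e) → h e }

  -- The invariant

  rank : Node → ℕ
  rank n = degree n + (if mark n then 1 else 0)

  Slack : Set
  Slack = Id → ℕ

  noSlack : Slack
  noSlack _ = 0

  -- The node that has just lost a child and awaits its cascading cut.
  slackAt : Id → Slack
  slackAt y c = if c ≡ᵇ y then 1 else 0

  record ChildEntry (s : Store) (sl : Slack) (x : Id) (k : Carrier) (i : ℕ) (c : Id) : Set (a ⊔ ℓ₂) where
    constructor childEntry
    field
      node     : Node
      stored   : s c ≡ just node
      isChild  : parent node ≡ just x
      ordered  : k ≼ key node
      ranked   : i ≤ rank node + sl c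

  data ChildrenOK (s : Store) (sl : Slack) (x : Id) (k : Carrier) : ℕ → List Id → Set (a ⊔ ℓ₂) where
    []  : ∀ {i} → ChildrenOK s sl x k i []
    _∷_ : ∀ {i c cs} → ChildEntry s sl x k i c → ChildrenOK s sl x k (suc i) cs →
          ChildrenOK s sl x k i (c ∷ cs)

  -- A finite parent chain from a node to a root, along which Q holds; this is how the
  -- absence of cycles is expressed.
  data Ancestry (s : Store) (Q : Id → Node → Set) : Id → Set a where
    root : ∀ {n nn} → s n ≡ just nn → parent nn ≡ nothing → Q n nn → Ancestry s Q n
    step : ∀ {n nn p} → s n ≡ just nn → parent nn ≡ just p → Q n nn → Ancestry s Q p →
           Ancestry s Q n

  Rooted : Store → Id → Set a
  Rooted s = Ancestry s (λ _ _ → ⊤)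

  AncestorsAbove : Store → ℕ → Id → Set a
  AncestorsAbove s e = Ancestry s (λ _ nm → e < degree nm)

  ParentLinked : Store → Id → Node → Set a
  ParentLinked s x nx = ∀ p → parent nx ≡ just p → Σ Node λ np → s p ≡ just np × x ∈ children np

  record NodeOK (s : Store) (sl : Slack) (x : Id) (nx : Node) : Set (a ⊔ ℓ₂) where
    constructor nodeOK
    field
      childrenOK     : ChildrenOK s sl x (key nx) 0 (children nx)
      uniqueChildren : Unique (children nx)
      parentLinked   : ParentLinked s x nx
      rooted         : Rooted s x

  WellFormed : Store → Slack → Set (a ⊔ ℓ₂)
  WellFormed s sl = ∀ x nx → s x ≡ just nx → NodeOK s sl x nx

  IsRoot : Store → Id → Set a
  IsRoot s v = Σ Node λ nv → s v ≡ just nv × parent nv ≡ nothing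

  record RootList (s : Store) (rs : List Id) : Set a where
    constructor rootList
    field
      uniqueRoots : Unique rs
      listedRoots : ∀ r → r ∈ rs → IsRoot s r
      allListed   : ∀ v nv → s v ≡ just nv → parent nv ≡ nothing → v ∈ rs

  data MinPointer (s : Store) : Maybe Id → Set (a ⊔ ℓ₂) where
    empty : (∀ i → s i ≡ nothing) → MinPointer s nothing
    atMin : ∀ {m} nm → s m ≡ just nm → parent nm ≡ nothing →
            (∀ v nv → s v ≡ just nv → key nm ≼ key nv) → MinPointer s (just m)

  record Invariant (H : Heap) : Set (a ⊔ ℓ₂) where
    constructor invariant
    field
      wellFormed : WellFormed (store H) noSlack
      rootsOK    : RootList (store H) (roots H)
      minOK      : MinPointer (store H) (min H)

  ChildrenOK-map : ∀ {s s′ sl sl′ x k k′ i l} → ChildrenOK s sl x k i l →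
    (∀ {j} c → c ∈ l → ChildEntry s sl x k j c → ChildEntry s′ sl′ x k′ j c) →
    ChildrenOK s′ sl′ x k′ i l
  ChildrenOK-map []       f = []
  ChildrenOK-map (c ∷ cs) f = f _ (here refl) c ∷ ChildrenOK-map cs (λ c → f c ∘ there)

  ChildrenOK-weaken : ∀ {s sl x k i j l} → j ≤ i → ChildrenOK s sl x k i l → ChildrenOK s sl x k j l
  ChildrenOK-weaken j≤i [] = []
  ChildrenOK-weaken j≤i (childEntry nc e p o r ∷ cs) =
    childEntry nc e p o (≤-trans j≤i r) ∷ ChildrenOK-weaken (s≤s j≤i) cs

  ChildrenOK-removeId : ∀ {s sl x k i l} y → ChildrenOK s sl x k i l → ChildrenOK s sl x k i (removeId y l)
  ChildrenOK-removeId y [] = []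
  ChildrenOK-removeId {l = c ∷ _} y (ce ∷ cs) with c ≡ᵇ y
  ... | true  = ChildrenOK-weaken (n≤1+n _) (ChildrenOK-removeId y cs)
  ... | false = ce ∷ ChildrenOK-removeId y cs

  ChildrenOK-∈ : ∀ {s sl x k i l c} → ChildrenOK s sl x k i l → c ∈ l → Σ ℕ λ j → ChildEntry s sl x k j c
  ChildrenOK-∈ (ce ∷ _)  (here refl) = _ , ce
  ChildrenOK-∈ (_  ∷ cs) (there c∈) = ChildrenOK-∈ cs c∈

  ChildrenOK-snoc : ∀ {s sl x k i l c} → ChildrenOK s sl x k i l → ChildEntry s sl x k (i + length l) c →
                    ChildrenOK s sl x k i (l ++ [ c ])
  ChildrenOK-snoc {i = i} [] (childEntry nc e p o r) =
    childEntry nc e p o (subst (_≤ _) (+-identityʳ i) r) ∷ []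
  ChildrenOK-snoc {s} {sl} {x} {k} {i} {_ ∷ l} {c} (ce ∷ cs) new =
    ce ∷ ChildrenOK-snoc cs (subst (λ j → ChildEntry s sl x k j c) (+-suc i (length l)) new)

  Ancestry-transport : ∀ {s s′ Q Q′} (good : Id → Set) →
    (∀ m nm → s m ≡ just nm → Q m nm → good m →
       Ancestry s′ Q′ m ⊎ (Σ Node λ nm′ → s′ m ≡ just nm′ × parent nm′ ≡ parent nm × Q′ m nm′ ×
                                (∀ p → parent nm ≡ just p → good p))) →
    ∀ {n} → Ancestry s Q n → good n → Ancestry s′ Q′ n
  Ancestry-transport good f (root e p q) g with f _ _ e q g
  ... | inj₁ anc = anc
  ... | inj₂ (_ , e′ , p′ , q′ , _) = root e′ (trans p′ p) q′
  Ancestry-transport good f (step e p q anc) g with f _ _ e q g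
  ... | inj₁ anc′ = anc′
  ... | inj₂ (_ , e′ , p′ , q′ , gp) = step e′ (trans p′ p) q′ (Ancestry-transport good f anc (gp _ p))

  Rooted-transport : ∀ {s s′} →
    (∀ m nm → s m ≡ just nm →
       Rooted s′ m ⊎ (Σ Node λ nm′ → s′ m ≡ just nm′ × parent nm′ ≡ parent nm)) →
    ∀ {n} → Rooted s n → Rooted s′ n
  Rooted-transport f anc = Ancestry-transport (λ _ → ⊤) move anc tt
    where
      move = λ m nm e _ _ → map₂ (λ { (nm′ , e′ , p′) → nm′ , e′ , p′ , tt , λ _ _ → tt }) (f m nm e)

  Ancestry-mono : ∀ {s Q Q′ n} → (∀ m nm → s m ≡ just nm → Q m nm → Q′ m nm) → Ancestry s Q n → Ancestry s Q′ n
  Ancestry-mono f (root e p q)     = root e p (f _ _ e q)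
  Ancestry-mono f (step e p q anc) = step e p (f _ _ e q) (Ancestry-mono f anc)

  Ancestry-acyclic : ∀ {s Q n nn} → Ancestry s Q n → s n ≡ just nn → parent nn ≢ just n
  Ancestry-acyclic (root e p _) e′ p′ with ≡just-unique e e′
  ... | refl = ≡just⇒≢nothing p′ p
  Ancestry-acyclic (step e p _ anc) e′ p′ with ≡just-unique e e′
  ... | refl with ≡just-unique p p′
  ...   | refl = Ancestry-acyclic anc e′ p′

  Ancestry-root : ∀ {s Q n} → Ancestry s Q n → Σ Id (IsRoot s)
  Ancestry-root (root {nn = nn} e p _) = _ , nn , e , p
  Ancestry-root (step _ _ _ anc)       = Ancestry-root anc

  _⊑_ : Store → Store → Set a
  s ⊑ s′ = ∀ i n → s i ≡ just n → s′ i ≡ just n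

  NodeOK-⊑ : ∀ {s s′ sl x nx} → s ⊑ s′ → NodeOK s sl x nx → NodeOK s′ sl x nx
  NodeOK-⊑ s⊑s′ (nodeOK cs u pl r) = nodeOK
    (ChildrenOK-map cs (λ { c _ (childEntry nc e p o k) → childEntry nc (s⊑s′ _ _ e) p o k }))
    u
    (λ q e → let (np , e₁ , m) = pl q e in np , s⊑s′ _ _ e₁ , m)
    (Rooted-transport (λ m nm e → inj₂ (nm , s⊑s′ _ _ e , refl)) r)

  -- The minimum pointer, INSERT and UNION

  data MinPointerExcept (s : Store) (x : Id) (nx : Node) : Maybe Id → Set (a ⊔ ℓ₂) where
    emptyExcept : (∀ v → v ≢ x → s v ≡ nothing) → MinPointerExcept s x nx nothing
    atMinExcept : ∀ {m} nm → s m ≡ just nm → parent nm ≡ nothing →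
                  (∀ v nv → v ≢ x → s v ≡ just nv → key nm ≼ key nv) →
                  (key nx ≺ key nm → parent nx ≡ nothing) →
                  MinPointerExcept s x nx (just m)

  newMin-just : ∀ s m x k nm → s m ≡ just nm → newMin s (just m) x k ≡ (if does (k ≺? key nm) then just x else just m)
  newMin-just s m x k nm e rewrite e = refl

  newMin-MinPointer : ∀ {s x nx mm} → s x ≡ just nx → parent nx ≡ nothing ⊎ mm ≢ nothing →
                      MinPointerExcept s x nx mm → MinPointer s (newMin s mm x (key nx))
  newMin-MinPointer {s} {x} {nx} ex (inj₁ px) (emptyExcept none) = atMin nx ex px λ v nv ev → case v ≟ x of λ where
    (yes refl) → subst (λ n → key nx ≼ key n) (≡just-unique ex ev) ≼-refl
    (no v≢x)   → ⊥-elim (≡just⇒≢nothing ev (none v v≢x))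
  newMin-MinPointer ex (inj₂ mm≢nothing) (emptyExcept _) = ⊥-elim (mm≢nothing refl)
  newMin-MinPointer {s} {x} {nx} {just m} ex _ (atMinExcept nm em pm minimal x-root)
    rewrite newMin-just s m x (key nx) nm em with key nx ≺? key nm
  ... | yes x≺m = atMin nx ex (x-root x≺m) λ v nv ev → case v ≟ x of λ where
    (yes refl) → subst (λ n → key nx ≼ key n) (≡just-unique ex ev) ≼-refl
    (no v≢x)   → ≺-≼-trans x≺m (minimal v nv v≢x ev)
  ... | no x⊀m = atMin nm em pm λ v nv ev → case v ≟ x of λ where
    (yes refl) → subst (λ n → key nm ≼ key n) (≡just-unique ex ev) x⊀m
    (no v≢x)   → minimal v nv v≢x ev

  newMin-cong : ∀ {s s′} mm x k → (∀ m → mm ≡ just m → s m ≡ s′ m) → newMin s mm x k ≡ newMin s′ mm x k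
  newMin-cong {s} {s′} nothing  x k _ = refl
  newMin-cong {s} {s′} (just m) x k h with s m | s′ m | h m refl
  ... | just _  | just _  | refl = refl
  ... | nothing | nothing | refl = refl

  min-stored : ∀ {s mm} → MinPointer s mm → ∀ m → mm ≡ just m → Σ Node λ nm → s m ≡ just nm
  min-stored (atMin nm em _ _) _ refl = nm , em

  module _ (H : Heap) (x : Id) (k : Carrier) (fresh : store H x ≡ nothing) where

    private
      singleton : Node
      singleton = record { key = k ; parent = nothing ; children = [] ; mark = false }

      s  = store H
      s′ = setNode s x (just singleton)

      stored≢x : ∀ {i n} → s i ≡ just n → i ≢ x
      stored≢x e refl = ≡just⇒≢nothing e fresh

      s⊑s′ : s ⊑ s′
      s⊑s′ i n e = trans (setNode-≢ s x _ i (stored≢x e)) e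

      new-min : ∀ {mm} → MinPointer s mm → MinPointerExcept s′ x singleton mm
      new-min (empty none) = emptyExcept λ v v≢x → trans (setNode-≢ s x _ v v≢x) (none v)
      new-min (atMin {m} nm em pm minimal) =
        atMinExcept nm (s⊑s′ m nm em) pm
          (λ v nv v≢x ev → minimal v nv (trans (sym (setNode-≢ s x _ v v≢x)) ev))
          (λ _ → refl)

    insert-invariant : Invariant H → Invariant (insertH H x k)
    insert-invariant (invariant wf (rootList ur lr al) mo) = invariant wf′ (rootList ur′ lr′ al′) mo′
      where
        wf′ : WellFormed s′ noSlack
        wf′ v nv ev with v ≟ x
        ... | yes refl with trans (sym (setNode-≡ s x _)) ev
        ...   | refl = nodeOK [] [] (λ _ ()) (root ev refl tt)
        wf′ v nv ev | no v≢x = NodeOK-⊑ s⊑s′ (wf v nv (trans (sym (setNode-≢ s x _ v v≢x)) ev))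
        x∉roots : x ∉ roots H
        x∉roots x∈ = let (_ , e , _) = lr x x∈ in stored≢x e refl
        ur′ : Unique (roots H ++ [ x ])
        ur′ = Unique.++⁺ ur ([] ∷ []) λ { (x∈ , here refl) → x∉roots x∈ }
        lr′ : ∀ r → r ∈ roots H ++ [ x ] → IsRoot s′ r
        lr′ r r∈ with ∈-++⁻ (roots H) r∈
        ... | inj₁ r∈H = let (nr , e , p) = lr r r∈H in nr , s⊑s′ _ _ e , p
        ... | inj₂ (here refl) = singleton , setNode-≡ s x _ , refl
        al′ : ∀ v nv → s′ v ≡ just nv → parent nv ≡ nothing → v ∈ roots H ++ [ x ]
        al′ v nv ev pv with v ≟ x
        ... | yes refl = ∈-++⁺ʳ (roots H) (here refl)
        ... | no v≢x   = ∈-++⁺ˡ (al v nv (trans (sym (setNode-≢ s x _ v v≢x)) ev) pv)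
        mo′ : MinPointer s′ (newMin s (min H) x k)
        mo′ rewrite newMin-cong (min H) x k (λ m e → let (nm , em) = min-stored mo m e in trans em (sym (s⊑s′ m nm em))) =
          newMin-MinPointer (setNode-≡ s x _) (inj₁ refl) (new-min mo)

  mergeStore-inv : ∀ s₁ s₂ i {n} → mergeStore s₁ s₂ i ≡ just n → s₁ i ≡ just n ⊎ s₂ i ≡ just n
  mergeStore-inv s₁ s₂ i e with s₁ i
  ... | just _  = inj₁ e
  ... | nothing = inj₂ e

  module _ (H₁ H₂ : Heap) (disjoint : Disjoint H₁ H₂) where

    private
      s₁ = store H₁
      s₂ = store H₂
      s  = mergeStore s₁ s₂

      s₁⊑s : s₁ ⊑ s
      s₁⊑s i n e rewrite e = refl

      s-right : ∀ i → s₁ i ≡ nothing → s i ≡ s₂ i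
      s-right i e rewrite e = refl

      s₂⊑s : s₂ ⊑ s
      s₂⊑s i n e with disjoint i
      ... | inj₁ free₁ = trans (s-right i free₁) e
      ... | inj₂ free₂ = ⊥-elim (≡just⇒≢nothing e free₂)

      union-min : MinPointer s₁ (min H₁) → MinPointer s₂ (min H₂) → MinPointer s (unionMin H₁ H₂)
      union-min mo₁ mo₂ with min H₁ | mo₁ | min H₂ | mo₂
      ... | nothing | empty none₁ | nothing | empty none₂ = empty λ i → trans (s-right i (none₁ i)) (none₂ i)
      ... | nothing | empty none₁ | just _  | atMin nm em pm minimal =
            atMin nm (s₂⊑s _ _ em) pm λ v nv ev → minimal v nv (trans (sym (s-right v (none₁ v))) ev)
      ... | just _  | atMin nm em pm minimal | nothing | empty none₂ =
            atMin nm (s₁⊑s _ _ em) pm λ v nv ev → case mergeStore-inv s₁ s₂ v ev of λ where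
              (inj₁ e₁) → minimal v nv e₁
              (inj₂ e₂) → ⊥-elim (≡just⇒≢nothing e₂ (none₂ v))
      ... | just _  | atMin n₁ e₁ p₁ min₁ | just _ | atMin n₂ e₂ p₂ min₂ rewrite e₁ | e₂
        with key n₂ ≺? key n₁
      ...   | yes n₂≺n₁ = atMin n₂ (s₂⊑s _ _ e₂) p₂ λ v nv ev → case mergeStore-inv s₁ s₂ v ev of λ where
              (inj₁ e₁′) → ≺-≼-trans n₂≺n₁ (min₁ v nv e₁′)
              (inj₂ e₂′) → min₂ v nv e₂′
      ...   | no n₂⊀n₁ = atMin n₁ (s₁⊑s _ _ e₁) p₁ λ v nv ev → case mergeStore-inv s₁ s₂ v ev of λ where
              (inj₁ e₁′) → min₁ v nv e₁′
              (inj₂ e₂′) → ≼-trans n₂⊀n₁ (min₂ v nv e₂′)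

    union-invariant : Invariant H₁ → Invariant H₂ → Invariant (unionH H₁ H₂)
    union-invariant (invariant wf₁ (rootList ur₁ lr₁ al₁) mo₁) (invariant wf₂ (rootList ur₂ lr₂ al₂) mo₂) =
      invariant wf (rootList ur lr al) (union-min mo₁ mo₂)
      where
        wf : WellFormed s noSlack
        wf v nv ev with mergeStore-inv s₁ s₂ v ev
        ... | inj₁ e₁ = NodeOK-⊑ s₁⊑s (wf₁ v nv e₁)
        ... | inj₂ e₂ = NodeOK-⊑ s₂⊑s (wf₂ v nv e₂)
        ur : Unique (roots H₁ ++ roots H₂)
        ur = Unique.++⁺ ur₁ ur₂ λ { {z} (z∈₁ , z∈₂) →
          let (_ , e₁ , _) = lr₁ z z∈₁ ; (_ , e₂ , _) = lr₂ z z∈₂ in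
          case disjoint z of λ where
            (inj₁ free₁) → ≡just⇒≢nothing e₁ free₁
            (inj₂ free₂) → ≡just⇒≢nothing e₂ free₂ }
        lr : ∀ r → r ∈ roots H₁ ++ roots H₂ → IsRoot s r
        lr r r∈ with ∈-++⁻ (roots H₁) r∈
        ... | inj₁ r∈₁ = let (nr , e , p) = lr₁ r r∈₁ in nr , s₁⊑s _ _ e , p
        ... | inj₂ r∈₂ = let (nr , e , p) = lr₂ r r∈₂ in nr , s₂⊑s _ _ e , p
        al : ∀ v nv → s v ≡ just nv → parent nv ≡ nothing → v ∈ roots H₁ ++ roots H₂
        al v nv ev pv with mergeStore-inv s₁ s₂ v ev
        ... | inj₁ e₁ = ∈-++⁺ˡ (al₁ v nv e₁ pv)
        ... | inj₂ e₂ = ∈-++⁺ʳ (roots H₁) (al₂ v nv e₂ pv)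

  -- Cuts, cascading cuts and DECREASE-KEY

  ≤-lose-child : ∀ {j d d′} b → d ≤ suc d′ → j ≤ d + b + 0 → j ≤ d′ + b + 1
  ≤-lose-child {j} {d} {d′} b d≤ j≤ = begin
    j            ≤⟨ j≤ ⟩
    d + b + 0    ≡⟨ +-identityʳ (d + b) ⟩
    d + b        ≤⟨ +-monoˡ-≤ b d≤ ⟩
    suc d′ + b   ≡⟨ cong suc (sym (+-identityʳ (d′ + b))) ⟩
    suc (d′ + b + 0) ≡⟨ sym (+-suc (d′ + b) 0) ⟩
    d′ + b + 1   ∎
    where open ≤-Reasoning

  slackAt-≡ : ∀ y → slackAt y y ≡ 1
  slackAt-≡ y rewrite ≡ᵇ-refl y = refl

  slackAt-≢ : ∀ {y c} → c ≢ y → slackAt y c ≡ 0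
  slackAt-≢ c≢y rewrite ≢⇒≡ᵇ-false c≢y = refl

  parent-≢ : ∀ {s sl x nx y} → WellFormed s sl → s x ≡ just nx → parent nx ≡ just y → x ≢ y
  parent-≢ wf ex px refl = Ancestry-acyclic (NodeOK.rooted (wf _ _ ex)) ex px

  -- Cascading cuts change no key and turn no root into a child, so the minimum pointer
  -- survives them.
  record KeysPreserved (s s′ : Store) : Set a where
    constructor keysPreserved
    field
      forth : ∀ i n → s i ≡ just n → Σ Node λ n′ → s′ i ≡ just n′ × key n′ ≡ key n ×
                                                  (parent n ≡ nothing → parent n′ ≡ nothing)
      back  : ∀ i n′ → s′ i ≡ just n′ → Σ Node λ n → s i ≡ just n × key n ≡ key n′

  KeysPreserved-refl : ∀ s → KeysPreserved s s
  KeysPreserved-refl s = keysPreserved (λ i n e → n , e , refl , λ p → p) (λ i n e → n , e , refl)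

  KeysPreserved-trans : ∀ {s₁ s₂ s₃} → KeysPreserved s₁ s₂ → KeysPreserved s₂ s₃ → KeysPreserved s₁ s₃
  KeysPreserved-trans (keysPreserved f₁ b₁) (keysPreserved f₂ b₂) = keysPreserved
    (λ i n e → let (n′ , e′ , k′ , p′) = f₁ i n e ; (n″ , e″ , k″ , p″) = f₂ i n′ e′ in
               n″ , e″ , trans k″ k′ , p″ ∘ p′)
    (λ i n e → let (n′ , e′ , k′) = b₂ i n e ; (n″ , e″ , k″) = b₁ i n′ e′ in n″ , e″ , trans k″ k′)

  MinExcept : Store → Id → Id → Set (a ⊔ ℓ₂)
  MinExcept s m x = m ≢ x × Σ Node λ nm → s m ≡ just nm × parent nm ≡ nothing ×
                    (∀ v nv → v ≢ x → s v ≡ just nv → key nm ≼ key nv)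

  MinExcept-transport : ∀ {s s′ m x} → KeysPreserved s s′ → MinExcept s m x → MinExcept s′ m x
  MinExcept-transport (keysPreserved f b) (m≢x , nm , em , pm , minimal) with f _ nm em
  ... | (nm′ , em′ , km , pm′) = m≢x , nm′ , em′ , pm′ pm , λ v nv v≢x ev →
        let (n₀ , e₀ , k₀) = b v nv ev in subst₂ _≼_ (sym km) k₀ (minimal v n₀ v≢x e₀)

  cutNode : Carrier → Node → Node
  cutNode k nx = unmark (setParent nothing (setKey k nx))

  record CutSpec (s s′ : Store) (x y : Id) (nx ny : Node) (k : Carrier) : Set a where
    field
      x≢y   : x ≢ y
      ex    : s x ≡ just nx
      px    : parent nx ≡ just y
      ey    : s y ≡ just ny
      ex′   : s′ x ≡ just (cutNode k nx)
      ey′   : s′ y ≡ just (dropChild x ny)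
      frame : ∀ j → j ≢ x → j ≢ y → s′ j ≡ s j

  module Cut {s s′ : Store} {x y : Id} {nx ny : Node} {k : Carrier} (C : CutSpec s s′ x y nx ny k) where
    open CutSpec C public

    shape : ∀ {j nj} → s j ≡ just nj → j ≢ x →
            (j ≡ y × nj ≡ ny × s′ j ≡ just (dropChild x ny)) ⊎ (j ≢ y × s′ j ≡ just nj)
    shape {j} e j≢x with j ≟ y
    ... | yes refl = inj₁ (refl , ≡just-unique e ey , ey′)
    ... | no j≢y   = inj₂ (j≢y , trans (frame j j≢x j≢y) e)

    shape′ : ∀ {j nj′} → s′ j ≡ just nj′ → j ≢ x →
             (j ≡ y × nj′ ≡ dropChild x ny) ⊎ (j ≢ y × s j ≡ just nj′)
    shape′ {j} e j≢x with j ≟ y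
    ... | yes refl = inj₁ (refl , ≡just-unique e ey′)
    ... | no j≢y   = inj₂ (j≢y , trans (sym (frame j j≢x j≢y)) e)

    cut-keysPreserved : k ≡ key nx → KeysPreserved s s′
    cut-keysPreserved k≡ = keysPreserved forth back
      where
        forth : ∀ i n → s i ≡ just n → Σ Node λ n′ → s′ i ≡ just n′ × key n′ ≡ key n ×
                                                    (parent n ≡ nothing → parent n′ ≡ nothing)
        forth i n e with i ≟ x
        ... | yes refl with ≡just-unique ex e
        ...   | refl = cutNode k nx , ex′ , k≡ , λ _ → refl
        forth i n e | no i≢x with shape e i≢x
        ... | inj₁ (refl , refl , e′) = dropChild x ny , e′ , refl , λ p → p
        ... | inj₂ (_ , e′)          = n , e′ , refl , λ p → p
        back : ∀ i n′ → s′ i ≡ just n′ → Σ Node λ n → s i ≡ just n × key n ≡ key n′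
        back i n′ e with i ≟ x
        ... | yes refl with ≡just-unique ex′ e
        ...   | refl = nx , ex , sym k≡
        back i n′ e | no i≢x with shape′ e i≢x
        ... | inj₁ (refl , refl) = ny , ey , refl
        ... | inj₂ (_ , e′)      = n′ , e′ , refl

    cut-MinExcept : ∀ {m} → MinExcept s m x → MinExcept s′ m x
    cut-MinExcept (m≢x , nm , em , pm , minimal) with shape em m≢x
    ... | inj₁ (refl , refl , em′) = m≢x , dropChild x ny , em′ , pm , minimal′
      where
        minimal′ : ∀ v nv → v ≢ x → s′ v ≡ just nv → key ny ≼ key nv
        minimal′ v nv v≢x ev with shape′ ev v≢x
        ... | inj₁ (refl , refl) = ≼-refl
        ... | inj₂ (_ , e) = minimal v nv v≢x e
    ... | inj₂ (_ , em′) = m≢x , nm , em′ , pm , minimal′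
      where
        minimal′ : ∀ v nv → v ≢ x → s′ v ≡ just nv → key nm ≼ key nv
        minimal′ v nv v≢x ev with shape′ ev v≢x
        ... | inj₁ (refl , refl) = minimal y ny v≢x ey
        ... | inj₂ (_ , e) = minimal v nv v≢x e

    module _ {sl : Slack} (sl-x : ∀ c → c ≢ x → sl c ≡ 0) (wf : WellFormed s sl) (k≼ : k ≼ key nx) where

      private
        y-unique : Unique (children ny)
        y-unique = NodeOK.uniqueChildren (wf y ny ey)

        entry : ∀ w {kk kk′} → kk′ ≼ kk → ∀ {j} c → c ≢ x →
                ChildEntry s sl w kk j c → ChildEntry s′ (slackAt y) w kk′ j c
        entry w kk′≼kk c c≢x (childEntry nc e p o r) with shape e c≢x
        ... | inj₁ (refl , refl , e′) =
          childEntry (dropChild x ny) e′ p (≼-trans kk′≼kk o)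
            (subst (λ t → _ ≤ rank (dropChild x ny) + t) (sym (slackAt-≡ y))
              (≤-lose-child _ (length-removeId x (children ny) y-unique)
                (subst (λ t → _ ≤ rank ny + t) (sl-x y (x≢y ∘ sym)) r)))
        ... | inj₂ (c≢y , e′) =
          childEntry nc e′ p (≼-trans kk′≼kk o)
            (subst (λ t → _ ≤ rank nc + t) (trans (sl-x c c≢x) (sym (slackAt-≢ c≢y))) r)

        linked : ∀ {v} nv nv′ → v ≢ x → parent nv′ ≡ parent nv → ParentLinked s v nv → ParentLinked s′ v nv′
        linked {v} _ _ v≢x pp pl p e with pl p (trans (sym pp) e)
        ... | (np , ep , v∈) with p ≟ x
        ...   | yes refl = cutNode k nx , ex′ , subst (λ n → v ∈ children n) (≡just-unique ep ex) v∈
        ...   | no p≢x with shape ep p≢x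
        ...     | inj₁ (refl , refl , e′) = dropChild x ny , e′ , ∈-removeId⁺ x (children ny) v∈ v≢x
        ...     | inj₂ (_ , e′) = np , e′ , v∈

        rooted : ∀ {v} → Rooted s v → Rooted s′ v
        rooted = Rooted-transport move
          where
            move : ∀ m nm → s m ≡ just nm → Rooted s′ m ⊎ (Σ Node λ nm′ → s′ m ≡ just nm′ × parent nm′ ≡ parent nm)
            move m nm e with m ≟ x
            ... | yes refl = inj₁ (root ex′ refl tt)
            ... | no m≢x with shape e m≢x
            ...   | inj₁ (refl , refl , e′) = inj₂ (dropChild x ny , e′ , refl)
            ...   | inj₂ (_ , e′) = inj₂ (nm , e′ , refl)

        child-≢x : ∀ {w nw} → s w ≡ just nw → w ≢ y → ∀ {c} → c ∈ children nw → c ≢ x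
        child-≢x ew w≢y c∈ refl with ChildrenOK-∈ (NodeOK.childrenOK (wf _ _ ew)) c∈
        ... | (_ , childEntry _ e p _ _) with ≡just-unique ex e
        ...   | refl = w≢y (just-injective (trans (sym p) px))

      cut-wellFormed : WellFormed s′ (slackAt y)
      cut-wellFormed v nv′ ev′ with v ≟ x
      ... | yes refl with ≡just-unique ex′ ev′
      ...   | refl = nodeOK
              (ChildrenOK-map (NodeOK.childrenOK (wf x nx ex)) λ c c∈ → entry x k≼ c (child-≢x ex x≢y c∈))
              (NodeOK.uniqueChildren (wf x nx ex)) (λ _ ()) (root ev′ refl tt)
      cut-wellFormed v nv′ ev′ | no v≢x with shape′ ev′ v≢x
      ... | inj₁ (refl , refl) = nodeOK
              (ChildrenOK-map (ChildrenOK-removeId x (NodeOK.childrenOK (wf y ny ey))) λ c c∈ →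
                entry y ≼-refl c (proj₂ (∈-removeId⁻ x (children ny) c∈)))
              (Unique.filter⁺ _ y-unique)
              (linked ny (dropChild x ny) v≢x refl (NodeOK.parentLinked (wf y ny ey)))
              (rooted (NodeOK.rooted (wf y ny ey)))
      ... | inj₂ (v≢y , ev) = nodeOK
              (ChildrenOK-map (NodeOK.childrenOK (wf v nv′ ev)) λ c c∈ → entry v ≼-refl c (child-≢x ev v≢y c∈))
              (NodeOK.uniqueChildren (wf v nv′ ev))
              (linked nv′ nv′ v≢x refl (NodeOK.parentLinked (wf v nv′ ev)))
              (rooted (NodeOK.rooted (wf v nv′ ev)))

      cut-rootList : ∀ {rs} → RootList s rs → RootList s′ (rs ++ [ x ])
      cut-rootList {rs} (rootList ur lr al) = rootList ur′ lr′ al′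
        where
          x∉ : x ∉ rs
          x∉ x∈ with lr x x∈
          ... | (_ , e , p) with ≡just-unique ex e
          ...   | refl = ≡just⇒≢nothing px p
          ur′ : Unique (rs ++ [ x ])
          ur′ = Unique.++⁺ ur ([] ∷ []) λ { (x∈ , here refl) → x∉ x∈ }
          lr′ : ∀ r → r ∈ rs ++ [ x ] → IsRoot s′ r
          lr′ r r∈ with ∈-++⁻ rs r∈
          ... | inj₂ (here refl) = cutNode k nx , ex′ , refl
          ... | inj₁ r∈rs with lr r r∈rs | r ≟ x
          ...   | _ | yes refl = ⊥-elim (x∉ r∈rs)
          ...   | (nr , e , p) | no r≢x with shape e r≢x
          ...     | inj₁ (refl , refl , e′) = dropChild x ny , e′ , p
          ...     | inj₂ (_ , e′) = nr , e′ , p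
          al′ : ∀ v nv → s′ v ≡ just nv → parent nv ≡ nothing → v ∈ rs ++ [ x ]
          al′ v nv ev pv with v ≟ x
          ... | yes refl = ∈-++⁺ʳ rs (here refl)
          ... | no v≢x with shape′ ev v≢x
          ...   | inj₁ (refl , refl) = ∈-++⁺ˡ (al y ny ey pv)
          ...   | inj₂ (_ , e) = ∈-++⁺ˡ (al v nv e pv)

  module Relabel {s : Store} {y : Id} {ny : Node} (f : Node → Node) (ey : s y ≡ just ny) where

    s′ : Store
    s′ = modify s y f

    ey′ : s′ y ≡ just (f ny)
    ey′ = modify-just s y f ey

    frame : ∀ {j} → j ≢ y → s′ j ≡ s j
    frame {j} = modify-≢ s y f j

    back : ∀ {j nj′} → s′ j ≡ just nj′ → (j ≡ y × nj′ ≡ f ny) ⊎ (j ≢ y × s j ≡ just nj′)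
    back {j} e with j ≟ y
    ... | yes refl = inj₁ (refl , ≡just-unique e ey′)
    ... | no j≢y   = inj₂ (j≢y , trans (sym (frame j≢y)) e)

    forth : ∀ {j nj} → s j ≡ just nj → (j ≡ y × nj ≡ ny) ⊎ (j ≢ y × s′ j ≡ just nj)
    forth {j} e with j ≟ y
    ... | yes refl = inj₁ (refl , ≡just-unique e ey)
    ... | no j≢y   = inj₂ (j≢y , trans (frame j≢y) e)

    module _ (keeps-children : children (f ny) ≡ children ny) (keeps-parent : parent (f ny) ≡ parent ny) where

      image : ∀ {j nj} → s j ≡ just nj → Σ Node λ nj′ → s′ j ≡ just nj′ × children nj′ ≡ children nj × parent nj′ ≡ parent nj
      image e with forth e
      ... | inj₁ (refl , refl) = f ny , ey′ , keeps-children , keeps-parent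
      ... | inj₂ (_ , e′)      = _ , e′ , refl , refl

      preimage : ∀ {j nj′} → s′ j ≡ just nj′ → Σ Node λ nj → s j ≡ just nj × children nj′ ≡ children nj × parent nj′ ≡ parent nj
      preimage e with back e
      ... | inj₁ (refl , refl) = ny , ey , keeps-children , keeps-parent
      ... | inj₂ (_ , e′)      = _ , e′ , refl , refl

      relabel-wellFormed : ∀ {sl sl′} → WellFormed s sl →
        (∀ {v nv nv′} → s v ≡ just nv → s′ v ≡ just nv′ → ∀ {j} c →
           ChildEntry s sl v (key nv) j c → ChildEntry s′ sl′ v (key nv′) j c) →
        WellFormed s′ sl′
      relabel-wellFormed wf entry v nv′ ev′ with preimage ev′
      ... | (nv , ev , ch , pp) with wf v nv ev
      ...   | nodeOK cs u pl r = nodeOK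
              (subst (ChildrenOK s′ _ v (key nv′) 0) (sym ch) (ChildrenOK-map cs λ c _ → entry ev ev′ c))
              (subst Unique (sym ch) u)
              (λ q e → let (np , ep , v∈) = pl q (trans (sym pp) e) ; (np′ , ep′ , ch′ , _) = image ep in
                       np′ , ep′ , subst (v ∈_) (sym ch′) v∈)
              (Rooted-transport (λ m nm e → let (nm′ , e′ , _ , pm) = image e in inj₂ (nm′ , e′ , pm)) r)

      relabel-rootList : ∀ {rs} → RootList s rs → RootList s′ rs
      relabel-rootList (rootList ur lr al) = rootList ur
        (λ r r∈ → let (nr , e , p) = lr r r∈ ; (nr′ , e′ , _ , pp) = image e in nr′ , e′ , trans pp p)
        (λ v nv e p → let (nv₀ , e₀ , _ , pp) = preimage e in al v nv₀ e₀ (trans (sym pp) p))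

  root-slack : ∀ {s y ny} → s y ≡ just ny → parent ny ≡ nothing → WellFormed s (slackAt y) → WellFormed s noSlack
  root-slack {s} {y} ey py wf v nv ev with wf v nv ev
  ... | nodeOK cs u pl r = nodeOK (ChildrenOK-map cs drop-slack) u pl r
    where
      drop-slack : ∀ {j} c → c ∈ children nv → ChildEntry s (slackAt y) v (key nv) j c → ChildEntry s noSlack v (key nv) j c
      drop-slack c _ (childEntry nc e p o k) with c ≟ y
      ... | yes refl = ⊥-elim (≡just⇒≢nothing p (subst (λ n → parent n ≡ nothing) (≡just-unique ey e) py))
      ... | no c≢y   = childEntry nc e p o (subst (λ t → _ ≤ rank nc + t) (slackAt-≢ c≢y) k)

  module Mark {s : Store} {y : Id} {ny : Node} (ey : s y ≡ just ny) where
    open Relabel {s} {y} {ny} markNode ey public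

    same-key : ∀ {v nv nv′} → s v ≡ just nv → s′ v ≡ just nv′ → key nv′ ≡ key nv
    same-key ev ev′ with back ev′
    ... | inj₁ (refl , refl) = cong key (≡just-unique ey ev)
    ... | inj₂ (_ , ev″)     = cong key (≡just-unique ev″ ev)

    mark-wellFormed : mark ny ≡ false → WellFormed s (slackAt y) → WellFormed s′ noSlack
    mark-wellFormed unmarked wf = relabel-wellFormed refl refl wf entry
      where
        entry : ∀ {v nv nv′} → s v ≡ just nv → s′ v ≡ just nv′ → ∀ {j} c →
                ChildEntry s (slackAt y) v (key nv) j c → ChildEntry s′ noSlack v (key nv′) j c
        entry ev ev′ {j} c (childEntry nc e p o k) with forth e
        ... | inj₁ (refl , refl) = childEntry (markNode ny) ey′ p (subst (_≼ key ny) (sym (same-key ev ev′)) o)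
                (begin
                  j                        ≤⟨ k ⟩
                  rank ny + slackAt y y    ≡⟨ cong₂ (λ b t → degree ny + b + t) (cong (λ m → if m then 1 else 0) unmarked) (slackAt-≡ y) ⟩
                  degree ny + 0 + 1        ≡⟨ +-assoc (degree ny) 0 1 ⟩
                  degree ny + 1            ≡⟨ sym (+-identityʳ _) ⟩
                  rank (markNode ny) + 0   ∎)
          where open ≤-Reasoning
        ... | inj₂ (c≢y , e′) = childEntry nc e′ p (subst (_≼ key nc) (sym (same-key ev ev′)) o)
                (subst (λ t → j ≤ rank nc + t) (slackAt-≢ c≢y) k)

    mark-rootList : ∀ {rs} → RootList s rs → RootList s′ rs
    mark-rootList = relabel-rootList refl refl

    mark-keysPreserved : KeysPreserved s s′
    mark-keysPreserved = keysPreserved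
      (λ i n e → case forth e of λ where
         (inj₁ (refl , refl)) → markNode ny , ey′ , refl , λ p → p
         (inj₂ (_ , e′))      → n , e′ , refl , λ p → p)
      (λ i n′ e′ → case back e′ of λ where
         (inj₁ (refl , refl)) → ny , ey , refl
         (inj₂ (_ , e))       → n′ , e , refl)

  -- H₀ is H, possibly with the key of x already lowered as in DECREASE-KEY.
  cut-spec : ∀ H₀ {s x y nx ny k} → store H₀ x ≡ just (setKey k nx) → (∀ j → j ≢ x → store H₀ j ≡ s j) →
             s x ≡ just nx → parent nx ≡ just y → s y ≡ just ny → x ≢ y →
             CutSpec s (store (cut H₀ x y)) x y nx ny k
  cut-spec H₀ {x = x} {y} e₀ frame₀ ex px ey x≢y = record
    { x≢y = x≢y ; ex = ex ; px = px ; ey = ey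
    ; ex′ = modify-just s₁ x orphaned (trans (modify-≢ (store H₀) y (dropChild x) x x≢y) e₀)
    ; ey′ = trans (modify-≢ s₁ x orphaned y (x≢y ∘ sym))
                  (modify-just (store H₀) y (dropChild x) (trans (frame₀ y (x≢y ∘ sym)) ey))
    ; frame = λ j j≢x j≢y → trans (modify-≢ s₁ x orphaned j j≢x)
                                  (trans (modify-≢ (store H₀) y (dropChild x) j j≢y) (frame₀ j j≢x)) }
    where
      s₁ = modify (store H₀) y (dropChild x)
      orphaned = λ n → unmark (setParent nothing n)

  record CascadeInvariant (H H′ : Heap) : Set (a ⊔ ℓ₂) where
    constructor cascadeInvariant
    field
      wellFormed′   : WellFormed (store H′) noSlack
      rootsOK′      : RootList (store H′) (roots H′)
      keysKept      : KeysPreserved (store H) (store H′)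
      sameMin       : min H′ ≡ min H

  cascadingCut-invariant : ∀ {H y H′} → CascadingCut H y H′ →
    WellFormed (store H) (slackAt y) → RootList (store H) (roots H) → CascadeInvariant H H′
  cascadingCut-invariant (cc-root ey py) wf rl =
    cascadeInvariant (root-slack ey py wf) rl (KeysPreserved-refl _) refl
  cascadingCut-invariant {H} {y} (cc-mark {ny = ny} ey py unmarked) wf rl =
    cascadeInvariant (mark-wellFormed unmarked wf) (mark-rootList rl) mark-keysPreserved refl
    where open Mark {store H} {y} {ny} ey
  cascadingCut-invariant {H} {y} (cc-cut {ny = ny} {z} ey py _ rest) wf rl
    with NodeOK.parentLinked (wf y ny ey) z py
  ... | (nz , ez , _) = extend (cascadingCut-invariant rest (cut-wellFormed (λ _ → slackAt-≢) wf ≼-refl) (cut-rootList (λ _ → slackAt-≢) wf ≼-refl rl))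
    where
      open Cut (cut-spec H ey (λ _ _ → refl) ey py ez (parent-≢ wf ey py))
      extend : ∀ {H′} → CascadeInvariant (cut H y z) H′ → CascadeInvariant H H′
      extend (cascadeInvariant wf′ rl′ kp′ min′) =
        cascadeInvariant wf′ rl′ (KeysPreserved-trans (cut-keysPreserved refl) kp′) min′

  module SetKey {s : Store} {x : Id} {nx : Node} (k : Carrier) (ex : s x ≡ just nx) (wf : WellFormed s noSlack) (k≼ : k ≼ key nx)
                (below-parent : ∀ y ny → parent nx ≡ just y → s y ≡ just ny → key ny ≼ k) where
    open Relabel {s} {x} {nx} (setKey k) ex public

    setKey-wellFormed : WellFormed s′ noSlack
    setKey-wellFormed = relabel-wellFormed refl refl wf entry
      where
        entry : ∀ {v nv nv′} → s v ≡ just nv → s′ v ≡ just nv′ → ∀ {j} c →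
                ChildEntry s noSlack v (key nv) j c → ChildEntry s′ noSlack v (key nv′) j c
        entry {v} ev ev′ c (childEntry nc e p o r) with forth e | back ev′
        ... | inj₁ (refl , refl) | inj₁ (refl , _) = ⊥-elim (Ancestry-acyclic (NodeOK.rooted (wf x nx ex)) ex p)
        ... | inj₁ (refl , refl) | inj₂ (_ , ev″) with ≡just-unique ev ev″
        ...   | refl = childEntry (setKey k nx) ey′ p (below-parent v _ p ev) r
        entry ev ev′ c (childEntry nc e p o r) | inj₂ (_ , e′) | inj₁ (refl , refl) with ≡just-unique ev ex
        ...   | refl = childEntry nc e′ p (≼-trans k≼ o) r
        entry ev ev′ c (childEntry nc e p o r) | inj₂ (_ , e′) | inj₂ (_ , ev″) with ≡just-unique ev ev″
        ...   | refl = childEntry nc e′ p o r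

    setKey-rootList : ∀ {rs} → RootList s rs → RootList s′ rs
    setKey-rootList = relabel-rootList refl refl

    setKey-MinPointerExcept : ∀ {mm} → MinPointer s mm → MinPointerExcept s′ x (setKey k nx) mm
    setKey-MinPointerExcept (empty none) = ⊥-elim (≡just⇒≢nothing ex (none x))
    setKey-MinPointerExcept (atMin {m} nm em pm minimal) with m ≟ x
    ... | yes refl with ≡just-unique ex em
    ...   | refl = atMinExcept (setKey k nx) ey′ pm
                     (λ v nv v≢x ev → ≼-trans k≼ (minimal v nv (trans (sym (frame v≢x)) ev)))
                     (λ k≺k → ⊥-elim (≼-refl k≺k))
    setKey-MinPointerExcept (atMin {m} nm em pm minimal) | no m≢x =
      atMinExcept nm (trans (frame m≢x) em) pm
        (λ v nv v≢x ev → minimal v nv (trans (sym (frame v≢x)) ev))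
        x-root
      where
        x-root : k ≺ key nm → parent nx ≡ nothing
        x-root k≺m = root-of (parent nx) refl
          where
            root-of : ∀ p → parent nx ≡ p → parent nx ≡ nothing
            root-of nothing  px = px
            root-of (just y) px with NodeOK.parentLinked (wf x nx ex) y px
            ... | (ny , ey , _) = ⊥-elim (≼-trans (minimal y ny ey) (below-parent y ny px ey) k≺m)

  min-nonempty : ∀ {s mm x nx} → MinPointer s mm → s x ≡ just nx → mm ≢ nothing
  min-nonempty (empty none) ex _ = ≡just⇒≢nothing ex (none _)
  min-nonempty (atMin _ _ _ _) _ ()

  decreaseKey-cut-invariant : ∀ {H x k nx y ny H′} → Invariant H →
    store H x ≡ just nx → k ≼ key nx → parent nx ≡ just y → store H y ≡ just ny →
    CascadingCut (cut (withKey H x k) x y) y H′ → Invariant (updMin H′ x k)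
  decreaseKey-cut-invariant {H} {x} {k} {nx} {y} {ny} {H′} (invariant wf rl mo) ex k≼ px ey cc =
    invariant wf′ rl′ (new-min (min H) refl mo)
    where
      open Cut (cut-spec (withKey H x k) (modify-just (store H) x (setKey k) ex) (λ j → modify-≢ (store H) x _ j)
                         ex px ey (parent-≢ wf ex px))
        using (ex′; cut-wellFormed; cut-rootList; cut-MinExcept)
      open CascadeInvariant (cascadingCut-invariant cc (cut-wellFormed (λ _ _ → refl) wf k≼) (cut-rootList (λ _ _ → refl) wf k≼ rl))
        renaming (wellFormed′ to wf′; rootsOK′ to rl′)
      new-min : ∀ mm → min H ≡ mm → MinPointer (store H) mm → MinPointer (store H′) (newMin (store H′) (min H′) x k)
      new-min _ _ (empty none) = ⊥-elim (≡just⇒≢nothing ex (none x))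
      new-min (just m) min≡m (atMin nm em pm minimal) with KeysPreserved.forth keysKept x (cutNode k nx) ex′
      ... | (nx′ , ex″ , kx , px′) =
        subst (λ mm → MinPointer (store H′) (newMin (store H′) mm x k)) (sym (trans sameMin min≡m))
          (subst (λ k′ → MinPointer (store H′) (newMin (store H′) (just m) x k′)) kx
            (newMin-MinPointer ex″ (inj₁ (px′ refl))
              (except (MinExcept-transport keysKept (cut-MinExcept (m≢x , nm , em , pm , λ v nv _ → minimal v nv))))))
        where
          m≢x : m ≢ x
          m≢x refl = ≡just⇒≢nothing px (subst (λ n → parent n ≡ nothing) (≡just-unique em ex) pm)
          except : MinExcept (store H′) m x → MinPointerExcept (store H′) x nx′ (just m)
          except (_ , nm′ , em′ , pm′ , minimal′) = atMinExcept nm′ em′ pm′ minimal′ (λ _ → px′ refl)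

  decreaseKey-invariant : ∀ {H x k H′} → DecreaseKey H x k H′ → Invariant H → Invariant H′
  decreaseKey-invariant {H} {x} {k} (dk-nocut-root {nx = nx} ex k≼ px) (invariant wf rl mo) =
    invariant setKey-wellFormed (setKey-rootList rl) (newMin-MinPointer ey′ (inj₁ px) (setKey-MinPointerExcept mo))
    where open SetKey k ex wf k≼ (λ y _ p → ⊥-elim (≡just⇒≢nothing p px))
  decreaseKey-invariant {H} {x} {k} (dk-nocut {nx = nx} {y = y} {ny = ny} ex k≼ px ey ny≼k) (invariant wf rl mo) =
    invariant setKey-wellFormed (setKey-rootList rl)
      (newMin-MinPointer ey′ (inj₂ (min-nonempty mo ex)) (setKey-MinPointerExcept mo))
    where
      below-parent : ∀ y′ ny′ → parent nx ≡ just y′ → store H y′ ≡ just ny′ → key ny′ ≼ k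
      below-parent y′ ny′ p e with just-injective (trans (sym px) p)
      ... | refl = subst (λ n → key n ≼ k) (≡just-unique ey e) ny≼k
      open SetKey k ex wf k≼ below-parent
  decreaseKey-invariant (dk-cut ex k≼ px ey _ cc) I = decreaseKey-cut-invariant I ex k≼ px ey cc

  -- Linking

  linkedNode : Id → Node → Node
  linkedNode q nc = unmark (setParent (just q) nc)

  degree-addChild : ∀ c n → degree (addChild c n) ≡ suc (degree n)
  degree-addChild c n = trans (length-++ (children n)) (+-comm (degree n) 1)

  record LinkSpec (s s′ : Store) (c q : Id) (nc nq : Node) : Set a where
    field
      c≢q   : c ≢ q
      ec    : s c ≡ just nc
      pc    : parent nc ≡ nothing
      eq    : s q ≡ just nq
      ec′   : s′ c ≡ just (linkedNode q nc)
      eq′   : s′ q ≡ just (addChild c nq)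
      frame : ∀ j → j ≢ c → j ≢ q → s′ j ≡ s j

  link-store : ∀ H {c q nc} → store H c ≡ just nc → parent nc ≡ nothing →
               store (link H c q) ≡ modify (modify (store H) c (linkedNode q)) q (addChild c)
  link-store H ec pc rewrite ec | pc = refl

  link-spec : ∀ H {c q nc nq} → store H c ≡ just nc → parent nc ≡ nothing → store H q ≡ just nq → c ≢ q →
              LinkSpec (store H) (store (link H c q)) c q nc nq
  link-spec H {c} {q} ec pc eq c≢q rewrite link-store H {q = q} ec pc = record
    { c≢q = c≢q ; ec = ec ; pc = pc ; eq = eq
    ; ec′ = trans (modify-≢ s₁ q (addChild c) c c≢q) (modify-just (store H) c (linkedNode q) ec)
    ; eq′ = modify-just s₁ q (addChild c) (trans (modify-≢ (store H) c _ q (c≢q ∘ sym)) eq)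
    ; frame = λ j j≢c j≢q → trans (modify-≢ s₁ q _ j j≢q) (modify-≢ (store H) c _ j j≢c) }
    where s₁ = modify (store H) c (linkedNode q)

  record Grows (n n′ : Node) : Set a where
    field
      same-key    : key n′ ≡ key n
      same-parent : parent n′ ≡ parent n
      same-mark   : mark n′ ≡ mark n
      more-degree : degree n ≤ degree n′
      more-children : ∀ {w} → w ∈ children n → w ∈ children n′

  Grows-rank : ∀ {n n′} → Grows n n′ → rank n ≤ rank n′
  Grows-rank {n} {n′} g rewrite Grows.same-mark g = +-monoˡ-≤ _ (Grows.more-degree g)

  module Link {s s′ : Store} {c q : Id} {nc nq : Node} (L : LinkSpec s s′ c q nc nq) where
    open LinkSpec L public

    grows : ∀ {j nj} → s j ≡ just nj → j ≢ c → Σ Node λ nj′ → s′ j ≡ just nj′ × Grows nj nj′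
    grows {j} e j≢c with j ≟ q
    ... | yes refl with ≡just-unique eq e
    ...   | refl = addChild c nq , eq′ , record
                     { same-key = refl ; same-parent = refl ; same-mark = refl
                     ; more-degree = subst (degree nq ≤_) (sym (degree-addChild c nq)) (n≤1+n _)
                     ; more-children = ∈-++⁺ˡ }
    grows {j} e j≢c | no j≢q = _ , trans (frame j j≢c j≢q) e , record
                     { same-key = refl ; same-parent = refl ; same-mark = refl
                     ; more-degree = ≤-refl ; more-children = λ w∈ → w∈ }

    back : ∀ {j nj′} → s′ j ≡ just nj′ →
           (j ≡ c × nj′ ≡ linkedNode q nc) ⊎ (j ≡ q × nj′ ≡ addChild c nq) ⊎ (j ≢ c × j ≢ q × s j ≡ just nj′)
    back {j} e with j ≟ c | j ≟ q
    ... | yes refl | _       = inj₁ (refl , ≡just-unique e ec′)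
    ... | no _     | yes refl = inj₂ (inj₁ (refl , ≡just-unique e eq′))
    ... | no j≢c   | no j≢q   = inj₂ (inj₂ (j≢c , j≢q , trans (sym (frame j j≢c j≢q)) e))

    AncestorsAbove-avoiding : ∀ {e n} → Ancestry s (λ m nm → e < degree nm × m ≢ c) n → AncestorsAbove s′ e n
    AncestorsAbove-avoiding anc = Ancestry-transport (λ _ → ⊤) move anc tt
      where
        move = λ m nm e (lt , m≢c) _ → let (nm′ , e′ , g) = grows e m≢c in
          inj₂ (nm′ , e′ , Grows.same-parent g , <-≤-trans lt (Grows.more-degree g) , λ _ _ → tt)

    module Attach (wf : WellFormed s noSlack) (dq : degree nq ≤ degree nc) (q≼c : key nq ≼ key nc)
             (rooted-q : Rooted s′ q) (above-q : ∀ e → e < degree nc → AncestorsAbove s′ e q) where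

      private
        entry : ∀ v k {j} w → ChildEntry s noSlack v k j w → ChildEntry s′ noSlack v k j w
        entry v k w (childEntry nw e p o r) with w ≟ c
        ... | yes refl = ⊥-elim (≡just⇒≢nothing p (subst (λ n → parent n ≡ nothing) (≡just-unique ec e) pc))
        ... | no w≢c with grows e w≢c
        ...   | (nw′ , e′ , g) = childEntry nw′ e′ (trans (Grows.same-parent g) p)
                                   (subst (k ≼_) (sym (Grows.same-key g)) o)
                                   (≤-trans r (+-monoˡ-≤ 0 (Grows-rank g)))

        c∉ : ∀ {v nv} → s v ≡ just nv → c ∉ children nv
        c∉ ev c∈ with ChildrenOK-∈ (NodeOK.childrenOK (wf _ _ ev)) c∈
        ... | (_ , childEntry _ e p _ _) =
          ≡just⇒≢nothing p (subst (λ n → parent n ≡ nothing) (≡just-unique ec e) pc)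

        rooted-c : Rooted s′ c
        rooted-c = step ec′ refl tt rooted-q

        rooted : ∀ {n} → Rooted s n → Rooted s′ n
        rooted = Rooted-transport move
          where
            move : ∀ m nm → s m ≡ just nm → Rooted s′ m ⊎ (Σ Node λ nm′ → s′ m ≡ just nm′ × parent nm′ ≡ parent nm)
            move m nm e with m ≟ c
            ... | yes refl = inj₁ rooted-c
            ... | no m≢c   = let (nm′ , e′ , g) = grows e m≢c in inj₂ (nm′ , e′ , Grows.same-parent g)

        linked : ∀ {v} nv nv′ → parent nv′ ≡ parent nv → ParentLinked s v nv → ParentLinked s′ v nv′
        linked _ _ pp pl p e with pl p (trans (sym pp) e)
        ... | (np , ep , v∈) with p ≟ c
        ...   | yes refl = linkedNode q nc , ec′ , subst (λ n → _ ∈ children n) (≡just-unique ep ec) v∈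
        ...   | no p≢c   = let (np′ , ep′ , g) = grows ep p≢c in np′ , ep′ , Grows.more-children g v∈

      link-AncestorsAbove : ∀ {e n} → AncestorsAbove s e n → AncestorsAbove s′ e n
      link-AncestorsAbove {e} anc = Ancestry-transport (λ _ → ⊤) move anc tt
        where
          move = λ m nm em lt _ → case m ≟ c of λ where
            (yes refl) → inj₁ (step ec′ refl (subst (λ n → e < degree n) (≡just-unique em ec) lt)
                                (above-q e (subst (λ n → e < degree n) (≡just-unique em ec) lt)))
            (no m≢c) → let (nm′ , e′ , g) = grows em m≢c in
                       inj₂ (nm′ , e′ , Grows.same-parent g , <-≤-trans lt (Grows.more-degree g) , λ _ _ → tt)

      link-wellFormed : WellFormed s′ noSlack
      link-wellFormed v nv′ ev′ with back ev′
      ... | inj₁ (refl , refl) = nodeOK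
              (ChildrenOK-map (NodeOK.childrenOK (wf c nc ec)) (λ w _ → entry c (key nc) w))
              (NodeOK.uniqueChildren (wf c nc ec))
              (λ p e → subst (λ t → Σ Node λ np → s′ t ≡ just np × c ∈ children np) (just-injective e)
                         (addChild c nq , eq′ , ∈-++⁺ʳ (children nq) (here refl)))
              rooted-c
      ... | inj₂ (inj₁ (refl , refl)) = nodeOK
              (ChildrenOK-snoc (ChildrenOK-map (NodeOK.childrenOK (wf q nq eq)) (λ w _ → entry q (key nq) w))
                 (childEntry (linkedNode q nc) ec′ refl q≼c
                    (subst (degree nq ≤_) (sym (trans (+-identityʳ _) (+-identityʳ _))) dq)))
              (Unique.++⁺ (NodeOK.uniqueChildren (wf q nq eq)) ([] ∷ []) λ { (c∈ , here refl) → c∉ eq c∈ })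
              (linked nq (addChild c nq) refl (NodeOK.parentLinked (wf q nq eq)))
              (rooted (NodeOK.rooted (wf q nq eq)))
      ... | inj₂ (inj₂ (_ , _ , ev)) = nodeOK
              (ChildrenOK-map (NodeOK.childrenOK (wf v nv′ ev)) (λ w _ → entry v (key nv′) w))
              (NodeOK.uniqueChildren (wf v nv′ ev))
              (linked nv′ nv′ refl (NodeOK.parentLinked (wf v nv′ ev)))
              (rooted (NodeOK.rooted (wf v nv′ ev)))

  -- APPEND

  -- A[e] is a root of degree e or e + 1, or a node linked below another one during the current
  -- CONSOLIDATE; such a node has degree e and only ancestors of larger degree, which is what keeps
  -- APPEND from creating a cycle when it links a root of degree e below it.
  record ArrayEntry (s : Store) (e : ℕ) (v : Id) : Set a where
    constructor arrayEntry
    field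
      node   : Node
      stored : s v ≡ just node
      status : (parent node ≡ nothing × e ≤ degree node × degree node ≤ suc e) ⊎
               (Σ Id λ p → parent node ≡ just p × degree node ≡ e × AncestorsAbove s e p)

  ArrayEntry-transport : ∀ {s s′ e v} → ArrayEntry s e v → s′ v ≡ s v →
                         (∀ {n} → AncestorsAbove s e n → AncestorsAbove s′ e n) → ArrayEntry s′ e v
  ArrayEntry-transport (arrayEntry nv ev (inj₁ r))                 eq _   = arrayEntry nv (trans eq ev) (inj₁ r)
  ArrayEntry-transport (arrayEntry nv ev (inj₂ (p , pp , dv , ab))) eq abv = arrayEntry nv (trans eq ev) (inj₂ (p , pp , dv , abv ab))

  ArrayEntry-root : ∀ {s e y ny} → ArrayEntry s e y → s y ≡ just ny → parent ny ≡ nothing →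
                    e ≤ degree ny × degree ny ≤ suc e
  ArrayEntry-root (arrayEntry _ ey′ entry) ey py with ≡just-unique ey ey′ | entry
  ... | refl | inj₁ (_ , bounds)      = bounds
  ... | refl | inj₂ (_ , pp , _ , _)  = ⊥-elim (≡just⇒≢nothing pp py)

  ArrayEntry-child : ∀ {s e y ny p} → ArrayEntry s e y → s y ≡ just ny → parent ny ≡ just p →
                     degree ny ≡ e × AncestorsAbove s e p
  ArrayEntry-child (arrayEntry _ ey′ entry) ey py with ≡just-unique ey ey′ | entry
  ... | refl | inj₁ (pp , _) = ⊥-elim (≡just⇒≢nothing py pp)
  ... | refl | inj₂ (_ , pp , dy , above) with just-injective (trans (sym py) pp)
  ...   | refl = dy , above

  degOf-stored : ∀ H {x nx} → store H x ≡ just nx → degOf H x ≡ degree nx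
  degOf-stored H ex rewrite ex = refl

  Injective : Arr → Set
  Injective A = ∀ e e′ v → getA A e ≡ just v → getA A e′ ≡ just v → e ≡ e′

  record AppendPre (H : Heap) (A : Arr) (x : Id) (d : ℕ) : Set (a ⊔ ℓ₂) where
    field
      wf        : WellFormed (store H) noSlack
      x-node    : Node
      x-stored  : store H x ≡ just x-node
      x-root    : parent x-node ≡ nothing
      x-degree  : degree x-node ≡ d
      entries   : ∀ e v → d ≤ e → getA A e ≡ just v → ArrayEntry (store H) e v
      injective : Injective A
      x-below   : ∀ e → getA A e ≡ just x → e < d

  record AppendPost (H : Heap) (A : Arr) (x : Id) (d : ℕ) (H′ : Heap) (A′ : Arr) : Set (a ⊔ ℓ₂) where
    field
      wf′            : WellFormed (store H′) noSlack
      entries′       : ∀ e v → d ≤ e → getA A′ e ≡ just v → ArrayEntry (store H′) e v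
      low-unchanged  : ∀ e → e < d → getA A′ e ≡ getA A e
      high-origin    : ∀ e v → d ≤ e → getA A′ e ≡ just v → v ≡ x ⊎ (Σ ℕ λ e′ → d ≤ e′ × getA A e′ ≡ just v)
      slot-d         : getA A′ d ≡ just x
      injective-but-x : ∀ e e′ v → getA A′ e ≡ just v → getA A′ e′ ≡ just v → e ≡ e′ ⊎ v ≡ x
      x-positions    : ∀ e → getA A′ e ≡ just x → e ≡ d ⊎ getA A e ≡ just x
      untouched      : ∀ v → v ≢ x → (∀ e → d ≤ e → getA A e ≢ just v) → store H′ v ≡ store H v
      ancestors-kept : ∀ {e n} → AncestorsAbove (store H) e n → AncestorsAbove (store H′) e n
      roots-tracked  : ∀ v nv → store H′ v ≡ just nv → parent nv ≡ nothing →
                       (Σ ℕ λ e → getA A′ e ≡ just v) ⊎ (v ≢ x × (∀ e → getA A e ≢ just v))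

  module FillSlot {H : Heap} {A : Arr} {x : Id} {d : ℕ} (P : AppendPre H A x d) where
    open AppendPre P

    private
      A′ = setA A d x
      old : ∀ {e} → e ≢ d → getA A′ e ≡ getA A e
      old {e} = getA-setA-≢ A d x e
      at-d : ∀ {v} → getA A′ d ≡ just v → v ≡ x
      at-d q = ≡just-unique q (getA-setA-≡ A d x)

    fill-entries : ∀ {H′} → ArrayEntry (store H′) d x →
      (∀ e v → d < e → getA A e ≡ just v → ArrayEntry (store H) e v → ArrayEntry (store H′) e v) →
      ∀ e v → d ≤ e → getA A′ e ≡ just v → ArrayEntry (store H′) e v
    fill-entries entry-x entries-above e v d≤e q with e ≟ d
    ... | yes refl rewrite at-d q = entry-x
    ... | no e≢d = entries-above e v (≤∧≢⇒< d≤e (e≢d ∘ sym)) q′ (entries e v d≤e q′)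
      where q′ = trans (sym (old e≢d)) q

    fill-high-origin : ∀ e v → d ≤ e → getA A′ e ≡ just v → v ≡ x ⊎ (Σ ℕ λ e′ → d ≤ e′ × getA A e′ ≡ just v)
    fill-high-origin e v d≤e q with e ≟ d
    ... | yes refl = inj₁ (at-d q)
    ... | no e≢d   = inj₂ (e , d≤e , trans (sym (old e≢d)) q)

    fill-injective : ∀ e e′ v → getA A′ e ≡ just v → getA A′ e′ ≡ just v → e ≡ e′ ⊎ v ≡ x
    fill-injective e e′ v q q′ with e ≟ d | e′ ≟ d
    ... | yes refl | _        = inj₂ (at-d q)
    ... | no _     | yes refl = inj₂ (at-d q′)
    ... | no e≢d   | no e′≢d  = inj₁ (injective e e′ v (trans (sym (old e≢d)) q) (trans (sym (old e′≢d)) q′))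

    fill-x-positions : ∀ e → getA A′ e ≡ just x → e ≡ d ⊎ getA A e ≡ just x
    fill-x-positions e q with e ≟ d
    ... | yes e≡d = inj₁ e≡d
    ... | no e≢d  = inj₂ (trans (sym (old e≢d)) q)

    fill-roots-tracked : ∀ {H′} → (∀ y → getA A d ≡ just y → y ≢ x → ∀ ny → store H′ y ≡ just ny → parent ny ≢ nothing) →
      ∀ v nv → store H′ v ≡ just nv → parent nv ≡ nothing →
      (Σ ℕ λ e → getA A′ e ≡ just v) ⊎ (v ≢ x × (∀ e → getA A e ≢ just v))
    fill-roots-tracked displaced v nv ev pv with v ≟ x
    ... | yes refl = inj₁ (d , getA-setA-≡ A d x)
    ... | no v≢x with v ∈A? A
    ...   | inj₂ absent = inj₂ (v≢x , absent)
    ...   | inj₁ (e , q) with e ≟ d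
    ...     | yes refl = ⊥-elim (displaced v q v≢x nv ev pv)
    ...     | no e≢d   = inj₁ (e , trans (old e≢d) q)

    fill-slot : ∀ {H′} →
      WellFormed (store H′) noSlack →
      ArrayEntry (store H′) d x →
      (∀ e v → d < e → getA A e ≡ just v → ArrayEntry (store H) e v → ArrayEntry (store H′) e v) →
      (∀ v → v ≢ x → (∀ e → d ≤ e → getA A e ≢ just v) → store H′ v ≡ store H v) →
      (∀ {e n} → AncestorsAbove (store H) e n → AncestorsAbove (store H′) e n) →
      (∀ y → getA A d ≡ just y → y ≢ x → ∀ ny → store H′ y ≡ just ny → parent ny ≢ nothing) →
      AppendPost H A x d H′ A′
    fill-slot {H′} wf′ entry-x entries-above untouched above displaced = record
      { wf′ = wf′ ; entries′ = fill-entries {H′} entry-x entries-above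
      ; low-unchanged = λ e e<d → old (<⇒≢ e<d) ; high-origin = fill-high-origin
      ; slot-d = getA-setA-≡ A d x ; injective-but-x = fill-injective ; x-positions = fill-x-positions
      ; untouched = untouched ; ancestors-kept = above ; roots-tracked = fill-roots-tracked {H′} displaced }

  open FillSlot using (fill-slot)

  -- APPEND(x, d) that links x below y = A[d] continues with APPEND(y, d + 1); the postcondition of
  -- that call is composed with the final step A[d] := x.
  module Reappend {H H₁ H₂ : Heap} {A A₂ : Arr} {x y : Id} {d d′ : ℕ} (d′≡ : d′ ≡ suc d)
                  (P : AppendPre H A x d) (ea : getA A d ≡ just y) (x≢y : x ≢ y)
                  (untouched₁ : ∀ v → v ≢ x → v ≢ y → store H₁ v ≡ store H v)
                  (above₁ : ∀ {e n} → AncestorsAbove (store H) e n → AncestorsAbove (store H₁) e n)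
                  (entry-x₁ : ArrayEntry (store H₁) d x) where
    open AppendPre P

    private
      y-only-at-d : ∀ {e} → getA A e ≡ just y → e ≡ d
      y-only-at-d q = injective _ d y q ea

      d<d′ : d < d′
      d<d′ = subst (d <_) (sym d′≡) ≤-refl

    reappend-pre : WellFormed (store H₁) noSlack → ∀ {ny₁} → store H₁ y ≡ just ny₁ → parent ny₁ ≡ nothing →
                   degree ny₁ ≡ d′ → AppendPre H₁ A y d′
    reappend-pre wf₁ {ny₁} ey₁ py₁ dy₁ = record
      { wf = wf₁ ; x-node = ny₁ ; x-stored = ey₁ ; x-root = py₁ ; x-degree = dy₁
      ; entries = entries₁ ; injective = injective
      ; x-below = λ e q → subst (e <_) (sym d′≡) (s≤s (≤-reflexive (y-only-at-d q))) }
      where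
        entries₁ : ∀ e v → d′ ≤ e → getA A e ≡ just v → ArrayEntry (store H₁) e v
        entries₁ e v d′≤e q with v ≟ x | v ≟ y
        ... | yes refl | _        = ⊥-elim (n≮n d (<-≤-trans (<-≤-trans d<d′ d′≤e) (<⇒≤ (x-below e q))))
        ... | no _     | yes refl = ⊥-elim (<⇒≢ (<-≤-trans d<d′ d′≤e) (sym (y-only-at-d q)))
        ... | no v≢x   | no v≢y   = ArrayEntry-transport (entries e v (<⇒≤ (<-≤-trans d<d′ d′≤e)) q) (untouched₁ v v≢x v≢y) above₁

    module _ (R : AppendPost H₁ A y d′ H₂ A₂) where
      open AppendPost R renaming (x-positions to y-positions)

      private
        A′ = setA A₂ d x
        old : ∀ {e} → e ≢ d → getA A′ e ≡ getA A₂ e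
        old {e} = getA-setA-≢ A₂ d x e
        at-d : ∀ {v} → getA A′ d ≡ just v → v ≡ x
        at-d q = ≡just-unique q (getA-setA-≡ A₂ d x)
        d≢-above : ∀ {e} → d ≤ e → e ≢ d → d′ ≤ e
        d≢-above d≤e e≢d = subst (_≤ _) (sym d′≡) (≤∧≢⇒< d≤e (e≢d ∘ sym))
        x-absent-above : ∀ e → d′ ≤ e → getA A e ≢ just x
        x-absent-above e d′≤e q = n≮n d (<-trans (<-≤-trans d<d′ d′≤e) (x-below e q))
        y-at-d : getA A₂ d ≡ just y
        y-at-d = trans (low-unchanged d d<d′) ea

      reappend-entries : ∀ e v → d ≤ e → getA A′ e ≡ just v → ArrayEntry (store H₂) e v
      reappend-entries e v d≤e q with e ≟ d
      ... | yes refl rewrite at-d q = ArrayEntry-transport entry-x₁ (untouched x x≢y x-absent-above) ancestors-kept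
      ... | no e≢d = entries′ e v (d≢-above d≤e e≢d) (trans (sym (old e≢d)) q)

      reappend-high : ∀ e v → d ≤ e → getA A′ e ≡ just v → v ≡ x ⊎ (Σ ℕ λ e′ → d ≤ e′ × getA A e′ ≡ just v)
      reappend-high e v d≤e q with e ≟ d
      ... | yes refl = inj₁ (at-d q)
      ... | no e≢d with high-origin e v (d≢-above d≤e e≢d) (trans (sym (old e≢d)) q)
      ...   | inj₁ refl = inj₂ (d , ≤-refl , ea)
      ...   | inj₂ (e′ , d′≤e′ , q′) = inj₂ (e′ , <⇒≤ (<-≤-trans d<d′ d′≤e′) , q′)

      reappend-injective : ∀ e e′ v → getA A′ e ≡ just v → getA A′ e′ ≡ just v → e ≡ e′ ⊎ v ≡ x
      reappend-injective e e′ v q q′ with e ≟ d | e′ ≟ d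
      ... | yes refl | _        = inj₂ (at-d q)
      ... | no _     | yes refl = inj₂ (at-d q′)
      ... | no e≢d   | no e′≢d  with injective-but-x e e′ v (trans (sym (old e≢d)) q) (trans (sym (old e′≢d)) q′)
      ...   | inj₁ e≡e′ = inj₁ e≡e′
      ...   | inj₂ refl = inj₁ (trans (at-d′ e≢d (trans (sym (old e≢d)) q)) (sym (at-d′ e′≢d (trans (sym (old e′≢d)) q′))))
        where
          at-d′ : ∀ {e} → e ≢ d → getA A₂ e ≡ just y → e ≡ d′
          at-d′ e≢d q with y-positions _ q
          ... | inj₁ e≡d′ = e≡d′
          ... | inj₂ q′   = ⊥-elim (e≢d (y-only-at-d q′))

      reappend-x-positions : ∀ e → getA A′ e ≡ just x → e ≡ d ⊎ getA A e ≡ just x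
      reappend-x-positions e q with e ≟ d
      ... | yes e≡d = inj₁ e≡d
      ... | no e≢d with e <? d′
      ...   | yes e<d′ = inj₂ (trans (sym (low-unchanged e e<d′)) (trans (sym (old e≢d)) q))
      ...   | no e≮d′ with high-origin e x (≮⇒≥ e≮d′) (trans (sym (old e≢d)) q)
      ...     | inj₁ x≡y = ⊥-elim (x≢y x≡y)
      ...     | inj₂ (e′ , d′≤e′ , q′) = ⊥-elim (x-absent-above e′ d′≤e′ q′)

      reappend-untouched : ∀ v → v ≢ x → (∀ e → d ≤ e → getA A e ≢ just v) → store H₂ v ≡ store H v
      reappend-untouched v v≢x absent = trans (untouched v v≢y (λ e d′≤e → absent e (<⇒≤ (<-≤-trans d<d′ d′≤e)))) (untouched₁ v v≢x v≢y)
        where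
          v≢y : v ≢ y
          v≢y refl = absent d ≤-refl ea

      reappend-roots : ∀ v nv → store H₂ v ≡ just nv → parent nv ≡ nothing →
                       (Σ ℕ λ e → getA A′ e ≡ just v) ⊎ (v ≢ x × (∀ e → getA A e ≢ just v))
      reappend-roots v nv ev pv with v ≟ x
      ... | yes refl = inj₁ (d , getA-setA-≡ A₂ d x)
      ... | no v≢x with roots-tracked v nv ev pv
      ...   | inj₂ (_ , absent) = inj₂ (v≢x , absent)
      ...   | inj₁ (e , q) with e ≟ d
      ...     | no e≢d = inj₁ (e , trans (old e≢d) q)
      ...     | yes refl with ≡just-unique y-at-d q
      ...       | refl = inj₁ (d′ , trans (old (<⇒≢ d<d′ ∘ sym)) slot-d)

      reappend-post : AppendPost H A x d H₂ A′
      reappend-post = record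
        { wf′ = wf′ ; entries′ = reappend-entries
        ; low-unchanged = λ e e<d → trans (old (<⇒≢ e<d)) (low-unchanged e (<-trans e<d d<d′))
        ; high-origin = reappend-high ; slot-d = getA-setA-≡ A₂ d x
        ; injective-but-x = reappend-injective ; x-positions = reappend-x-positions
        ; untouched = reappend-untouched ; ancestors-kept = ancestors-kept ∘ above₁
        ; roots-tracked = reappend-roots }

  module AppendCase {H : Heap} {A : Arr} {x : Id} {d : ℕ} (P : AppendPre H A x d) where
    open AppendPre P

    entry-x : ArrayEntry (store H) d x
    entry-x = arrayEntry x-node x-stored (inj₁ (x-root , ≤-reflexive (sym x-degree) , ≤-trans (≤-reflexive x-degree) (n≤1+n d)))

    slot-≢x : ∀ {y} → getA A d ≡ just y → y ≢ x
    slot-≢x ea refl = n≮n d (x-below d ea)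

    no-link : (∀ y → getA A d ≡ just y → y ≢ x → ∀ ny → store H y ≡ just ny → parent ny ≢ nothing) →
              AppendPost H A x d H (setA A d x)
    no-link displaced = fill-slot P wf entry-x (λ _ _ _ _ en → en) (λ _ _ _ → refl) (λ ab → ab) displaced

    module AfterLink {c q : Id} {nc nq : Node} {y : Id} (L : LinkSpec (store H) (store (link H c q)) c q nc nq)
                     (ea : getA A d ≡ just y) (pair : (c ≡ x × q ≡ y) ⊎ (c ≡ y × q ≡ x)) where
      open LinkSpec L using (frame)

      outside-pair : ∀ {v} → v ≢ x → v ≢ y → store (link H c q) v ≡ store H v
      outside-pair {v} v≢x v≢y = by-pair pair
        where
          by-pair : (c ≡ x × q ≡ y) ⊎ (c ≡ y × q ≡ x) → store (link H c q) v ≡ store H v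
          by-pair (inj₁ (refl , refl)) = frame v v≢x v≢y
          by-pair (inj₂ (refl , refl)) = frame v v≢y v≢x

      entries-above : (∀ {e n} → AncestorsAbove (store H) e n → AncestorsAbove (store (link H c q)) e n) →
                      ∀ e v → d < e → getA A e ≡ just v → ArrayEntry (store H) e v → ArrayEntry (store (link H c q)) e v
      entries-above above e v d<e q en with v ≟ x | v ≟ y
      ... | yes refl | _        = ⊥-elim (n≮n d (<-trans d<e (x-below e q)))
      ... | no _     | yes refl = ⊥-elim (<⇒≢ d<e (sym (injective e d v q ea)))
      ... | no v≢x   | no v≢y   = ArrayEntry-transport en (outside-pair v≢x v≢y) above

      untouched : ∀ v → v ≢ x → (∀ e → d ≤ e → getA A e ≢ just v) → store (link H c q) v ≡ store H v
      untouched v v≢x absent = outside-pair v≢x λ { refl → absent d ≤-refl ea }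

  displaced-nonroot : ∀ (s : Store) {slot y ny p x} → slot ≡ just y → s y ≡ just ny → parent ny ≡ just p →
                      ∀ y′ → slot ≡ just y′ → y′ ≢ x → ∀ ny′ → s y′ ≡ just ny′ → parent ny′ ≢ nothing
  displaced-nonroot _ ea ey py y′ ea′ _ ny′ ey′ with ≡just-unique ea ea′
  ... | refl with ≡just-unique ey ey′
  ...   | refl = ≡just⇒≢nothing py

  append-nil : ∀ {H A x d} → AppendPre H A x d → getA A d ≡ nothing → AppendPost H A x d H (setA A d x)
  append-nil P ea = no-link (λ y q → ⊥-elim (≡just⇒≢nothing q ea))
    where open AppendCase P

  append-ge-child : ∀ {H A x d y ny p} → AppendPre H A x d → getA A d ≡ just y → store H y ≡ just ny →
                    parent ny ≡ just p → AppendPost H A x d H (setA A d x)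
  append-ge-child {H} P ea ey py = no-link (displaced-nonroot (store H) ea ey py)
    where open AppendCase P

  append-ge-root : ∀ {H A x d y nx ny} → AppendPre H A x d → getA A d ≡ just y → store H x ≡ just nx →
                   store H y ≡ just ny → key nx ≼ key ny → parent ny ≡ nothing →
                   AppendPost H A x d (link H y x) (setA A d x)
  append-ge-root {H} {A} {x} {d} {y} {nx} {ny} P ea ex ey x≼y py with ≡just-unique (AppendPre.x-stored P) ex
  ... | refl = fill-slot P link-wellFormed entry-x′ (entries-above link-AncestorsAbove) untouched
                 link-AncestorsAbove (displaced-nonroot (store (link H y x)) ea ec′ refl)
    where
      open AppendPre P
      open AppendCase P using (slot-≢x; module AfterLink)
      L = link-spec H ey py ex (slot-≢x ea)
      bounds : d ≤ degree ny × degree ny ≤ suc d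
      bounds = ArrayEntry-root (entries d y ≤-refl ea) ey py
      degree-x′ : degree (addChild y nx) ≡ suc d
      degree-x′ = trans (degree-addChild y nx) (cong suc x-degree)
      open Link L
      open AfterLink L ea (inj₂ (refl , refl))
      open Attach wf (≤-trans (≤-reflexive x-degree) (proj₁ bounds)) x≼y (root eq′ x-root tt)
                  (λ e e<dy → root eq′ x-root (subst (e <_) (sym degree-x′) (s≤s (≤-pred (≤-trans e<dy (proj₂ bounds))))))
      entry-x′ : ArrayEntry (store (link H y x)) d x
      entry-x′ = arrayEntry (addChild y nx) eq′ (inj₁ (x-root , ≤-trans (n≤1+n d) (≤-reflexive (sym degree-x′)) , ≤-reflexive degree-x′))

  append-lt-child : ∀ {H A x d y nx ny p} → AppendPre H A x d → getA A d ≡ just y → store H x ≡ just nx →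
                    store H y ≡ just ny → key ny ≺ key nx → parent ny ≡ just p →
                    AppendPost H A x d (if degree ny ≡ᵇ d then link H x y else H) (setA A d x)
  append-lt-child {H} {A} {x} {d} {y} {nx} {ny} {p} P ea ex ey y≺x py
    with ≡just-unique (AppendPre.x-stored P) ex | degree ny ≡ᵇ d in degree≟
  ... | refl | false = AppendCase.no-link P (displaced-nonroot (store H) ea ey py)
  ... | refl | true  = fill-slot P link-wellFormed entry-x′ (entries-above link-AncestorsAbove) untouched
                         link-AncestorsAbove (displaced-nonroot (store (link H x y)) ea eq′ py)
    where
      open AppendPre P
      open AppendCase P using (slot-≢x; module AfterLink)
      L = link-spec H ex x-root ey (slot-≢x ea ∘ sym)
      open Link L
      open AfterLink L ea (inj₁ (refl , refl))
      degree-y : degree ny ≡ d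
      degree-y = ≡ᵇ-true⇒≡ degree≟
      degree-y′ : degree (addChild x ny) ≡ suc d
      degree-y′ = trans (degree-addChild x ny) (cong suc degree-y)
      above-p : AncestorsAbove (store H) d p
      above-p = proj₂ (ArrayEntry-child (entries d y ≤-refl ea) ey py)
      -- x has degree d, so it is not among the ancestors of p: linking x below y creates no cycle.
      above-p′ : ∀ e → e ≤ d → AncestorsAbove (store (link H x y)) e p
      above-p′ e e≤d = AncestorsAbove-avoiding (Ancestry-mono avoid above-p)
        where
          avoid : ∀ m nm → store H m ≡ just nm → d < degree nm → e < degree nm × m ≢ x
          avoid m nm em d<m = ≤-<-trans e≤d d<m ,
            λ { refl → n≮n d (subst (d <_) (trans (cong degree (≡just-unique em x-stored)) x-degree) d<m) }
      open Attach wf (≤-trans (≤-reflexive degree-y) (≤-reflexive (sym x-degree))) (≺⇒≼ y≺x)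
                  (step eq′ py tt (Ancestry-mono (λ _ _ _ _ → tt) (above-p′ d ≤-refl)))
                  (λ e e<dx → step eq′ py (subst (e <_) (sym degree-y′) (≤-trans e<dx (≤-trans (≤-reflexive x-degree) (n≤1+n d))))
                                 (above-p′ e (<⇒≤ (subst (e <_) x-degree e<dx))))
      entry-x′ : ArrayEntry (store (link H x y)) d x
      entry-x′ = arrayEntry (linkedNode y x-node) ec′
        (inj₂ (y , refl , x-degree , step eq′ py (subst (d <_) (sym degree-y′) ≤-refl) (above-p′ d ≤-refl)))

  append-lt-root : ∀ {H A x d y nx ny H₂ A₂} → AppendPre H A x d → getA A d ≡ just y → store H x ≡ just nx →
    store H y ≡ just ny → key ny ≺ key nx → parent ny ≡ nothing →
    let H₁ = if degree ny ≡ᵇ d then link H x y else H in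
    (AppendPre H₁ A y (degOf H₁ y) → AppendPost H₁ A y (degOf H₁ y) H₂ A₂) →
    AppendPost H A x d H₂ (setA A₂ d x)
  append-lt-root {H} {A} {x} {d} {y} {nx} {ny} P ea ex ey y≺x py recurse
    with ≡just-unique (AppendPre.x-stored P) ex | degree ny ≡ᵇ d in degree≟
  ... | refl | false = reappend-post (recurse (reappend-pre wf ey py (sym (degOf-stored H ey))))
    where
      open AppendPre P
      open AppendCase P using (slot-≢x; entry-x)
      bounds = ArrayEntry-root (entries d y ≤-refl ea) ey py
      degree-y : degree ny ≡ suc d
      degree-y = ≤-antisym (proj₂ bounds) (≤∧≢⇒< (proj₁ bounds) (≡ᵇ-false⇒≢ degree≟ ∘ sym))
      open Reappend (trans (degOf-stored H ey) degree-y) P ea (slot-≢x ea ∘ sym) (λ _ _ _ → refl) (λ ab → ab) entry-x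
  ... | refl | true = reappend-post (recurse (reappend-pre link-wellFormed eq′ py (sym (degOf-stored (link H x y) eq′))))
    where
      open AppendPre P
      open AppendCase P using (slot-≢x)
      L = link-spec H ex x-root ey (slot-≢x ea ∘ sym)
      open Link L
      degree-y′ : degree (addChild x ny) ≡ suc d
      degree-y′ = trans (degree-addChild x ny) (cong suc (≡ᵇ-true⇒≡ degree≟))
      open Attach wf (≤-trans (≤-reflexive (≡ᵇ-true⇒≡ degree≟)) (≤-reflexive (sym x-degree))) (≺⇒≼ y≺x)
                  (root eq′ py tt)
                  (λ e e<dx → root eq′ py (subst (e <_) (sym degree-y′) (≤-trans e<dx (≤-trans (≤-reflexive x-degree) (n≤1+n d)))))
      open Reappend (trans (degOf-stored (link H x y) eq′) degree-y′) P ea (slot-≢x ea ∘ sym) (λ v v≢x v≢y → frame v v≢x v≢y)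
                    link-AncestorsAbove
                    (arrayEntry (linkedNode y x-node) ec′ (inj₂ (y , refl , x-degree , root eq′ py (subst (d <_) (sym degree-y′) ≤-refl))))

  append-invariant : ∀ {H A x d H′ A′} → Append H A x d H′ A′ → AppendPre H A x d → AppendPost H A x d H′ A′
  append-invariant (app-nil ea)                       P = append-nil P ea
  append-invariant (app-lt-root ea ex ey y≺x py rest) P = append-lt-root P ea ex ey y≺x py (append-invariant rest)
  append-invariant (app-lt-child ea ex ey y≺x py)     P = append-lt-child P ea ex ey y≺x py
  append-invariant (app-ge-root ea ex ey x≼y py)      P = append-ge-root P ea ex ey x≼y py
  append-invariant (app-ge-child ea ex ey _ py)       P = append-ge-child P ea ey py

  -- CONSOLIDATE

  record ConsolidateInv (H : Heap) (A : Arr) (xs : List Id) : Set (a ⊔ ℓ₂) where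
    field
      wf             : WellFormed (store H) noSlack
      entries        : ∀ e v → getA A e ≡ just v → ArrayEntry (store H) e v
      injective      : Injective A
      unique-pending : Unique xs
      pending-roots  : ∀ r → r ∈ xs → IsRoot (store H) r
      pending-absent : ∀ r → r ∈ xs → ∀ e → getA A e ≢ just r
      roots-covered  : ∀ v nv → store H v ≡ just nv → parent nv ≡ nothing → (Σ ℕ λ e → getA A e ≡ just v) ⊎ v ∈ xs

  module AppendStep {H : Heap} {A : Arr} {x : Id} {xs : List Id} {H₁ : Heap} {A₁ : Arr}
                    (ap : Append H A x (degOf H x) H₁ A₁) (C : ConsolidateInv H A (x ∷ xs)) where
    open ConsolidateInv C

    private
      d = degOf H x
      x-is-root = pending-roots x (here refl)
      x-absent = pending-absent x (here refl)
      pre : AppendPre H A x d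
      pre = record
        { wf = wf ; x-node = proj₁ x-is-root ; x-stored = proj₁ (proj₂ x-is-root)
        ; x-root = proj₂ (proj₂ x-is-root) ; x-degree = sym (degOf-stored H (proj₁ (proj₂ x-is-root)))
        ; entries = λ e v _ → entries e v ; injective = injective
        ; x-below = λ e q → ⊥-elim (x-absent e q) }
      open AppendPost (append-invariant ap pre)

      r≢x : ∀ {r} → r ∈ xs → r ≢ x
      r≢x r∈ refl = Unique.Unique[x∷xs]⇒x∉xs unique-pending r∈

    step-entries : ∀ e v → getA A₁ e ≡ just v → ArrayEntry (store H₁) e v
    step-entries e v q with e <? d
    ... | no e≮d = entries′ e v (≮⇒≥ e≮d) q
    ... | yes e<d = ArrayEntry-transport (entries e v q₀) (untouched v v≢x only-at-e) ancestors-kept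
      where
        q₀ = trans (sym (low-unchanged e e<d)) q
        v≢x : v ≢ x
        v≢x refl = x-absent e q₀
        only-at-e : ∀ e′ → d ≤ e′ → getA A e′ ≢ just v
        only-at-e e′ d≤e′ q′ with injective e e′ v q₀ q′
        ... | refl = n≮n e (<-≤-trans e<d d≤e′)

    step-injective : Injective A₁
    step-injective e e′ v q q′ with injective-but-x e e′ v q q′
    ... | inj₁ e≡e′ = e≡e′
    ... | inj₂ refl with x-positions e q | x-positions e′ q′
    ...   | inj₁ e≡d | inj₁ e′≡d = trans e≡d (sym e′≡d)
    ...   | inj₂ q₀  | _         = ⊥-elim (x-absent e q₀)
    ...   | _        | inj₂ q₀   = ⊥-elim (x-absent e′ q₀)

    step-absent : ∀ r → r ∈ xs → ∀ e → getA A₁ e ≢ just r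
    step-absent r r∈ e q with e <? d
    ... | yes e<d = pending-absent r (there r∈) e (trans (sym (low-unchanged e e<d)) q)
    ... | no e≮d with high-origin e r (≮⇒≥ e≮d) q
    ...   | inj₁ refl = r≢x r∈ refl
    ...   | inj₂ (e′ , _ , q′) = pending-absent r (there r∈) e′ q′

    step-covered : ∀ v nv → store H₁ v ≡ just nv → parent nv ≡ nothing → (Σ ℕ λ e → getA A₁ e ≡ just v) ⊎ v ∈ xs
    step-covered v nv ev pv with roots-tracked v nv ev pv
    ... | inj₁ found = inj₁ found
    ... | inj₂ (v≢x , absent) with roots-covered v nv (trans (sym (untouched v v≢x (λ e _ → absent e))) ev) pv
    ...   | inj₁ (e , q)      = ⊥-elim (absent e q)
    ...   | inj₂ (here refl)  = ⊥-elim (v≢x refl)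
    ...   | inj₂ (there v∈)   = inj₂ v∈

    appendAll-step : ConsolidateInv H₁ A₁ xs
    appendAll-step = record
      { wf = wf′ ; entries = step-entries ; injective = step-injective
      ; unique-pending = tail unique-pending
      ; pending-roots = λ r r∈ → subst (λ t → Σ Node λ n → t ≡ just n × parent n ≡ nothing)
                                       (sym (untouched r (r≢x r∈) (λ e _ → pending-absent r (there r∈) e)))
                                       (pending-roots r (there r∈))
      ; pending-absent = step-absent ; roots-covered = step-covered }

  open AppendStep using (appendAll-step)

  appendAll-invariant : ∀ {H A xs H′ A′} → AppendAll H A xs H′ A′ → ConsolidateInv H A xs → ConsolidateInv H′ A′ []
  appendAll-invariant aa-nil              C = C
  appendAll-invariant (aa-cons ap rest) C = appendAll-invariant rest (appendAll-step ap C)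

  data MinOfList (s : Store) (rs : List Id) : Maybe Id → Set (a ⊔ ℓ₂) where
    none : rs ≡ [] → MinOfList s rs nothing
    some : ∀ {m} nm → s m ≡ just nm → parent nm ≡ nothing →
           (∀ r → r ∈ rs → ∀ nr → s r ≡ just nr → key nm ≼ key nr) → MinOfList s rs (just m)

  MinOfList-snoc : ∀ {s rs mm x nx} → s x ≡ just nx → parent nx ≡ nothing → MinOfList s rs mm →
                   MinOfList s (rs ++ [ x ]) (newMin s mm x (key nx))
  MinOfList-snoc {x = x} {nx} ex px (none refl) =
    some nx ex px λ { r (here refl) nr er → subst (λ n → key nx ≼ key n) (≡just-unique ex er) ≼-refl }
  MinOfList-snoc {s} {rs} {just m} {x} {nx} ex px (some nm em pm minimal)
    rewrite newMin-just s m x (key nx) nm em with key nx ≺? key nm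
  ... | yes x≺m = some nx ex px λ r r∈ nr er → case ∈-++⁻ rs r∈ of λ where
          (inj₁ r∈rs)      → ≺-≼-trans x≺m (minimal r r∈rs nr er)
          (inj₂ (here refl)) → subst (λ n → key nx ≼ key n) (≡just-unique ex er) ≼-refl
  ... | no x⊀m = some nm em pm λ r r∈ nr er → case ∈-++⁻ rs r∈ of λ where
          (inj₁ r∈rs)      → minimal r r∈rs nr er
          (inj₂ (here refl)) → subst (λ n → key nm ≼ key n) (≡just-unique ex er) x⊀m

  record RebuildOut (s : Store) (A : Arr) (rs : List Id) (out : List Id × Maybe Id) : Set (a ⊔ ℓ₂) where
    field
      unique-out : Unique (proj₁ out)
      roots-out  : ∀ r → r ∈ proj₁ out → IsRoot s r
      keeps-old  : ∀ r → r ∈ rs → r ∈ proj₁ out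
      adds-new   : ∀ e v → getA A e ≡ just v → IsRoot s v → v ∈ proj₁ out
      min-out    : MinOfList s (proj₁ out) (proj₂ out)

  rebuild-skip : ∀ {s A rs out} w → (∀ {v} → w ≡ just v → ¬ IsRoot s v) → RebuildOut s A rs out → RebuildOut s (w ∷ A) rs out
  rebuild-skip w not-root R = record
    { unique-out = unique-out ; roots-out = roots-out ; keeps-old = keeps-old ; min-out = min-out
    ; adds-new = λ where
        zero    v q is-root → ⊥-elim (not-root q is-root)
        (suc e) v q is-root → adds-new e v q is-root }
    where open RebuildOut R

  Injective-tail : ∀ {w A} → Injective (w ∷ A) → Injective A
  Injective-tail inj e e′ v q q′ = cong pred (inj (suc e) (suc e′) v q q′)

  rebuild-correct : ∀ s A rs mm → Unique rs → (∀ r → r ∈ rs → IsRoot s r) → (∀ r → r ∈ rs → ∀ e → getA A e ≢ just r) →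
                    Injective A → MinOfList s rs mm → RebuildOut s A rs (rebuild s A rs mm)
  rebuild-correct s [] rs mm u roots _ _ mo = record
    { unique-out = u ; roots-out = roots ; keeps-old = λ _ r∈ → r∈
    ; adds-new = λ e v q → ⊥-elim (≡just⇒≢nothing q (getA-[] e)) ; min-out = mo }
  rebuild-correct s (nothing ∷ A) rs mm u roots absent inj mo =
    rebuild-skip nothing (λ ()) (rebuild-correct s A rs mm u roots (λ r r∈ e → absent r r∈ (suc e)) (Injective-tail inj) mo)
  rebuild-correct s (just x ∷ A) rs mm u roots absent inj mo with s x in ex
  ... | nothing = rebuild-skip (just x) (λ { refl (_ , e , _) → ≡just⇒≢nothing e ex })
                   (rebuild-correct s A rs mm u roots (λ r r∈ e → absent r r∈ (suc e)) (Injective-tail inj) mo)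
  ... | just nx with parent nx in px
  ...   | just _ = rebuild-skip (just x)
                     (λ { refl (_ , e , p) → ≡just⇒≢nothing px (subst (λ n → parent n ≡ nothing) (≡just-unique e ex) p) })
                     (rebuild-correct s A rs mm u roots (λ r r∈ e → absent r r∈ (suc e)) (Injective-tail inj) mo)
  ...   | nothing = record
      { unique-out = R.unique-out ; roots-out = R.roots-out ; min-out = R.min-out
      ; keeps-old = λ r r∈ → R.keeps-old r (∈-++⁺ˡ r∈)
      ; adds-new = λ where
          zero    v refl _ → R.keeps-old x (∈-++⁺ʳ rs (here refl))
          (suc e) v q is-root → R.adds-new e v q is-root }
    where
      R = rebuild-correct s A (rs ++ [ x ]) (newMin s mm x (key nx))
            (Unique.++⁺ u ([] ∷ []) λ { (x∈ , here refl) → absent x x∈ zero refl })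
            (λ r r∈ → case ∈-++⁻ rs r∈ of λ where
               (inj₁ r∈rs)        → roots r r∈rs
               (inj₂ (here refl)) → nx , ex , px)
            (λ r r∈ e q → case ∈-++⁻ rs r∈ of λ where
               (inj₁ r∈rs)        → absent r r∈rs (suc e) q
               (inj₂ (here refl)) → case inj zero (suc e) r refl q of λ ())
            (Injective-tail inj)
            (MinOfList-snoc ex px mo)
      module R = RebuildOut R

  root-below : ∀ {s} → WellFormed s noSlack → ∀ {n nn} → Rooted s n → s n ≡ just nn →
               Σ Id λ r → Σ Node λ nr → s r ≡ just nr × parent nr ≡ nothing × key nr ≼ key nn
  root-below wf (root {n = n} e p _) e′ with ≡just-unique e e′
  ... | refl = n , _ , e , p , ≼-refl
  root-below wf (step {n = n} {p = p} e pp _ anc) e′ with ≡just-unique e e′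
  ... | refl with NodeOK.parentLinked (wf n _ e) p pp
  ...   | (np , ep , n∈) with ChildrenOK-∈ (NodeOK.childrenOK (wf p np ep)) n∈ | root-below wf anc ep
  ...     | (_ , childEntry _ en _ p≼n _) | (r , nr , er , pr , r≼p) with ≡just-unique en e
  ...       | refl = r , nr , er , pr , ≼-trans r≼p p≼n

  no-roots⇒empty : ∀ {s} → WellFormed s noSlack → RootList s [] → ∀ i → s i ≡ nothing
  no-roots⇒empty {s} wf rl i with s i in e
  ... | nothing = refl
  ... | just n with Ancestry-root (NodeOK.rooted (wf i n e))
  ...   | (r , nr , er , pr) with RootList.allListed rl r nr er pr
  ...     | ()

  finishConsolidate-≡ : ∀ H A → finishConsolidate H A ≡
    record H { roots = proj₁ (rebuild (store H) A [] nothing) ; min = proj₂ (rebuild (store H) A [] nothing) }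
  finishConsolidate-≡ H A with rebuild (store H) A [] nothing
  ... | _ , _ = refl

  finish-invariant : ∀ {H A} → ConsolidateInv H A [] → Invariant (finishConsolidate H A)
  finish-invariant {H} {A} C rewrite finishConsolidate-≡ H A = invariant wf (rootList unique-out roots-out listed) (to-min min-out)
    where
      open ConsolidateInv C
      open RebuildOut (rebuild-correct (store H) A [] nothing [] (λ _ ()) (λ _ ()) injective (none refl))
      listed : ∀ v nv → store H v ≡ just nv → parent nv ≡ nothing → v ∈ proj₁ (rebuild (store H) A [] nothing)
      listed v nv ev pv with roots-covered v nv ev pv
      ... | inj₁ (e , q) = adds-new e v q (nv , ev , pv)
      rs = proj₁ (rebuild (store H) A [] nothing)
      to-min : ∀ {mm} → MinOfList (store H) rs mm → MinPointer (store H) mm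
      to-min (none rs≡[]) = empty (no-roots⇒empty wf (subst (RootList (store H)) rs≡[] (rootList unique-out roots-out listed)))
      to-min (some nm em pm minimal) = atMin nm em pm λ v nv ev →
        let (r , nr , er , pr , r≼v) = root-below wf (NodeOK.rooted (wf v nv ev)) ev in
        ≼-trans (minimal r (listed r nr er pr) nr er) r≼v

  -- EXTRACT-MIN and reachable heaps

  orphan-∉ : ∀ s cs j → j ∉ cs → orphan s cs j ≡ s j
  orphan-∉ s []       j _   = refl
  orphan-∉ s (c ∷ cs) j j∉ = trans (orphan-∉ (modify s c (setParent nothing)) cs j (j∉ ∘ there))
                                   (modify-≢ s c _ j (j∉ ∘ here))

  orphan-∈ : ∀ s cs j → j ∈ cs → orphan s cs j ≡ Maybe.map (setParent nothing) (s j)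
  orphan-∈ s (c ∷ cs) j j∈ with j ∈? cs | j ≟ c
  ... | yes j∈cs | yes refl = trans (orphan-∈ (modify s c _) cs j j∈cs) (trans (cong (Maybe.map _) (modify-≡ s c _)) (map-twice (s j)))
    where
      map-twice : ∀ m → Maybe.map (setParent nothing) (Maybe.map (setParent nothing) m) ≡ Maybe.map (setParent nothing) m
      map-twice nothing  = refl
      map-twice (just _) = refl
  ... | yes j∈cs | no j≢c   = trans (orphan-∈ (modify s c _) cs j j∈cs) (cong (Maybe.map _) (modify-≢ s c _ j j≢c))
  ... | no j∉cs  | _        with j∈
  ...   | here refl  = trans (orphan-∉ (modify s c _) cs c j∉cs) (modify-≡ s c _)
  ...   | there j∈cs = ⊥-elim (j∉cs j∈cs)

  module RemoveMin {H : Heap} {z : Id} {nz : Node} (wf : WellFormed (store H) noSlack) (rl : RootList (store H) (roots H))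
                   (ez : store H z ≡ just nz) (pz : parent nz ≡ nothing) where

    private
      s  = store H
      cs = children nz
      s₀ = store (removeMin H z nz)

      z-removed : s₀ z ≡ nothing
      z-removed = setNode-≡ (orphan s cs) z nothing

      child-of-z : ∀ {c} → c ∈ cs → Σ Node λ nc → s c ≡ just nc × parent nc ≡ just z
      child-of-z c∈ with ChildrenOK-∈ (NodeOK.childrenOK (wf z nz ez)) c∈
      ... | (_ , childEntry nc ec pc _ _) = nc , ec , pc

      z∉cs : z ∉ cs
      z∉cs z∈ = let (_ , ec , pc) = child-of-z z∈ in
        ≡just⇒≢nothing pc (subst (λ n → parent n ≡ nothing) (≡just-unique ez ec) pz)

      promoted : ∀ {j} → j ∈ cs → s₀ j ≡ Maybe.map (setParent nothing) (s j)
      promoted {j} j∈ = trans (setNode-≢ (orphan s cs) z nothing j (λ { refl → z∉cs j∈ })) (orphan-∈ s cs j j∈)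

      kept : ∀ {j} → j ≢ z → j ∉ cs → s₀ j ≡ s j
      kept {j} j≢z j∉ = trans (setNode-≢ (orphan s cs) z nothing j j≢z) (orphan-∉ s cs j j∉)

      parent-≢z : ∀ {v nv p} → s v ≡ just nv → parent nv ≡ just p → v ∉ cs → p ≢ z
      parent-≢z ev pv v∉ refl with NodeOK.parentLinked (wf _ _ ev) z pv
      ... | (_ , ez′ , v∈) rewrite ≡just-unique ez ez′ = v∉ v∈

      grandchild-∉cs : ∀ {v nv} → s v ≡ just nv → v ≢ z → ∀ {w} → w ∈ children nv → w ∉ cs
      grandchild-∉cs ev v≢z w∈ w∈cs with ChildrenOK-∈ (NodeOK.childrenOK (wf _ _ ev)) w∈ | child-of-z w∈cs
      ... | (_ , childEntry _ ew pw _ _) | (_ , ew′ , pw′) with ≡just-unique ew ew′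
      ...   | refl = v≢z (just-injective (trans (sym pw) pw′))

      child-≢z : ∀ {v nv} → s v ≡ just nv → ∀ {w} → w ∈ children nv → w ≢ z
      child-≢z ev w∈ refl with ChildrenOK-∈ (NodeOK.childrenOK (wf _ _ ev)) w∈
      ... | (_ , childEntry _ ew pw _ _) =
        ≡just⇒≢nothing pw (subst (λ n → parent n ≡ nothing) (≡just-unique ez ew) pz)

      back : ∀ {v nv′} → s₀ v ≡ just nv′ → v ≢ z × Σ Node λ nv → s v ≡ just nv ×
             ((v ∈ cs × nv′ ≡ setParent nothing nv) ⊎ (v ∉ cs × nv′ ≡ nv))
      back {v} e with v ≟ z
      ... | yes refl = ⊥-elim (≡just⇒≢nothing e z-removed)
      ... | no v≢z with v ∈? cs
      ...   | no v∉  = v≢z , _ , trans (sym (kept v≢z v∉)) e , inj₂ (v∉ , refl)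
      ...   | yes v∈ with s v in ev
      ...     | just nv = v≢z , nv , refl , inj₁ (v∈ , just-injective (trans (sym e) (trans (promoted v∈) (cong (Maybe.map _) ev))))
      ...     | nothing = ⊥-elim (≡just⇒≢nothing e (trans (promoted v∈) (cong (Maybe.map _) ev)))

      forth : ∀ {v nv} → s v ≡ just nv → v ≢ z → Σ Node λ nv′ → s₀ v ≡ just nv′ × children nv′ ≡ children nv ×
              ((v ∈ cs × parent nv′ ≡ nothing) ⊎ (v ∉ cs × parent nv′ ≡ parent nv))
      forth {v} {nv} ev v≢z with v ∈? cs
      ... | yes v∈ = setParent nothing nv , trans (promoted v∈) (cong (Maybe.map _) ev) , refl , inj₁ (v∈ , refl)
      ... | no v∉  = nv , trans (kept v≢z v∉) ev , refl , inj₂ (v∉ , refl)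

      rooted₀ : ∀ {v nv} → s v ≡ just nv → v ≢ z → Rooted s₀ v
      rooted₀ ev v≢z = Ancestry-transport (_≢ z) move (NodeOK.rooted (wf _ _ ev)) v≢z
        where
          move = λ m nm em _ m≢z → case forth em m≢z of λ where
            (nm′ , em′ , _ , inj₁ (_ , pm′))   → inj₁ (root em′ pm′ tt)
            (nm′ , em′ , _ , inj₂ (m∉ , pm′)) → inj₂ (nm′ , em′ , pm′ , tt , λ q pq → parent-≢z em pq m∉)

      children₀ : ∀ {v nv} → s v ≡ just nv → v ≢ z → ChildrenOK s₀ noSlack v (key nv) 0 (children nv)
      children₀ ev v≢z = ChildrenOK-map (NodeOK.childrenOK (wf _ _ ev)) λ where
        w w∈ (childEntry nw ew pw o r) → childEntry nw (trans (kept (child-≢z ev w∈) (grandchild-∉cs ev v≢z w∈)) ew) pw o r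

    removeMin-wellFormed : WellFormed s₀ noSlack
    removeMin-wellFormed v nv′ ev′ with back ev′
    ... | (v≢z , nv , ev , inj₁ (_ , refl)) =
      nodeOK (children₀ ev v≢z) (NodeOK.uniqueChildren (wf v nv ev)) (λ _ ()) (rooted₀ ev v≢z)
    ... | (v≢z , nv , ev , inj₂ (v∉ , refl)) =
      nodeOK (children₀ ev v≢z) (NodeOK.uniqueChildren (wf v nv ev)) linked (rooted₀ ev v≢z)
      where
        linked : ParentLinked s₀ v nv
        linked q pq with NodeOK.parentLinked (wf v nv ev) q pq
        ... | (nq , eq , v∈) = let (nq′ , eq′ , same , _) = forth eq (parent-≢z ev pq v∉) in
                               nq′ , eq′ , subst (v ∈_) (sym same) v∈

    removeMin-rootList : RootList s₀ (removeId z (roots H) ++ cs)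
    removeMin-rootList = rootList unique listed all-listed
      where
        open RootList rl
        unique : Unique (removeId z (roots H) ++ cs)
        unique = Unique.++⁺ (Unique.filter⁺ _ uniqueRoots) (NodeOK.uniqueChildren (wf z nz ez)) λ { {r} (r∈ , r∈cs) →
          let (_ , er , pr) = listedRoots r (proj₁ (∈-removeId⁻ z (roots H) r∈)) ; (_ , ec , pc) = child-of-z r∈cs in
          ≡just⇒≢nothing pc (subst (λ n → parent n ≡ nothing) (≡just-unique er ec) pr) }
        listed : ∀ r → r ∈ removeId z (roots H) ++ cs → IsRoot s₀ r
        listed r r∈ with ∈-++⁻ (removeId z (roots H)) r∈
        ... | inj₂ r∈cs = let (nc , ec , _) = child-of-z r∈cs in
                          setParent nothing nc , trans (promoted r∈cs) (cong (Maybe.map _) ec) , refl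
        ... | inj₁ r∈′ with ∈-removeId⁻ z (roots H) r∈′
        ...   | (r∈roots , r≢z) with listedRoots r r∈roots
        ...     | (nr , er , pr) with forth er r≢z
        ...       | (nr′ , er′ , _ , inj₁ (_ , p′)) = nr′ , er′ , p′
        ...       | (nr′ , er′ , _ , inj₂ (_ , p′)) = nr′ , er′ , trans p′ pr
        all-listed : ∀ v nv → s₀ v ≡ just nv → parent nv ≡ nothing → v ∈ removeId z (roots H) ++ cs
        all-listed v nv′ ev′ pv with back ev′
        ... | (v≢z , nv , ev , inj₁ (v∈cs , _))   = ∈-++⁺ʳ _ v∈cs
        ... | (v≢z , nv , ev , inj₂ (_ , refl)) = ∈-++⁺ˡ (∈-removeId⁺ z (roots H) (allListed v nv ev pv) v≢z)

  min-is-root : ∀ {s mm z nz} → MinPointer s mm → mm ≡ just z → s z ≡ just nz → parent nz ≡ nothing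
  min-is-root (atMin nm em pm _) refl ez rewrite ≡just-unique ez em = pm

  extractMin-invariant : ∀ {H H′} → ExtractMin H H′ → Invariant H → Invariant H′
  extractMin-invariant {H} (extract-empty {z = z} {nz} mz ez no-roots) (invariant wf rl mo) =
    invariant removeMin-wellFormed removeMin-rootList
      (empty (no-roots⇒empty removeMin-wellFormed (subst (RootList _) no-roots removeMin-rootList)))
    where open RemoveMin {H} {z} {nz} wf rl ez (min-is-root mo mz ez)
  extractMin-invariant {H} (extract-cons {z = z} {nz} mz ez _ (consolidate aa)) (invariant wf rl mo) =
    finish-invariant (appendAll-invariant aa record
      { wf = removeMin-wellFormed
      ; entries = λ e v q → ⊥-elim (≡just⇒≢nothing q (getA-[] e))
      ; injective = λ e e′ v q → ⊥-elim (≡just⇒≢nothing q (getA-[] e))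
      ; unique-pending = RootList.uniqueRoots removeMin-rootList
      ; pending-roots = RootList.listedRoots removeMin-rootList
      ; pending-absent = λ r _ e q → ≡just⇒≢nothing q (getA-[] e)
      ; roots-covered = λ v nv ev pv → inj₂ (RootList.allListed removeMin-rootList v nv ev pv) })
    where open RemoveMin {H} {z} {nz} wf rl ez (min-is-root mo mz ez)

  reachable-invariant : ∀ {H} → Reachable H → Invariant H
  reachable-invariant r-empty                 = invariant (λ _ _ ()) (rootList [] (λ _ ()) (λ _ _ ())) (empty λ _ → refl)
  reachable-invariant (r-insert r x fresh k)  = insert-invariant _ x k fresh (reachable-invariant r)
  reachable-invariant (r-union r₁ r₂ disjoint) = union-invariant _ _ disjoint (reachable-invariant r₁) (reachable-invariant r₂)
  reachable-invariant (r-extract r em)        = extractMin-invariant em (reachable-invariant r)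
  reachable-invariant (r-decrease r dk)       = decreaseKey-invariant dk (reachable-invariant r)

  lookup-ranked : ∀ {s sl x k j l} → ChildrenOK s sl x k j l → (i : Fin (length l)) → ∀ {ny} →
                  s (lookup l i) ≡ just ny → toℕ i + j ≤ rank ny + sl (lookup l i)
  lookup-ranked (childEntry _ e _ _ r ∷ _) fzero e′ with ≡just-unique e e′
  ... | refl = r
  lookup-ranked {sl = sl} {j = j} {_ ∷ l} (_ ∷ cs) (fsuc i) {ny} e′ =
    subst (_≤ rank ny + sl (lookup l i)) (+-suc (toℕ i) j) (lookup-ranked cs i e′)

  rank-bound⇒degree-bound : ∀ n {i} → i ≤ rank n → suc i ∸ 2 ≤ degree n
  rank-bound⇒degree-bound n {i} i≤rank with mark n
  ... | true  = subst (i ∸ 1 ≤_) (m+n∸n≡m (degree n) 1) (∸-monoˡ-≤ 1 i≤rank)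
  ... | false = ≤-trans (m∸n≤m i 1) (subst (i ≤_) (+-identityʳ (degree n)) i≤rank)

  reachable-ranked : ∀ {H} → Reachable H → ∀ {x nx} → store H x ≡ just nx → (i : Fin (degree nx)) → ∀ {ny} →
                     store H (lookup (children nx) i) ≡ just ny → toℕ i ≤ rank ny
  reachable-ranked r ex i ey =
    subst₂ _≤_ (+-identityʳ _) (+-identityʳ _)
      (lookup-ranked (NodeOK.childrenOK (Invariant.wellFormed (reachable-invariant r) _ _ ex)) i ey)

lemma1 : ∀ {a ℓ₁ ℓ₂} (O : StrictTotalOrder a ℓ₁ ℓ₂) →
  let open FibHeap O in
  ∀ (H : Heap) → Reachable H →
  ∀ (x : Id) (nx : Node) → store H x ≡ just nx →
  ∀ (i : Fin (degree nx)) (ny : Node) →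
  store H (lookup (children nx) i) ≡ just ny →
  suc (toℕ i) ∸ 2 ≤ degree ny
lemma1 O H reachable x nx ex i ny ey = rank-bound⇒degree-bound O ny (reachable-ranked O reachable ex i ey)
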